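{- There is a computable $c:\mathcal{P}_{fin}(\mathbb{N})\rightarrow\{0,1\}$ such that if $\mathcal{S}\subseteq\mathcal{P}_{fin}(\mathbb{N})$ is computably enumerable and generates an IP set, then $c$ is not constant on $NU(\mathcal{S})$.
   Context: $\mathcal{P}_{fin}(\mathbb{N})$ is the set of finite subsets of $\mathbb{N}$, identified with $\mathbb{N}$ via a fixed computable bijection (so computability notions apply). $NU(\mathcal{S})$ is the set of non-empty sets which are unions of finitely many elements of $\mathcal{S}$. $\mathcal{S}$ generates an IP set if $\mathcal{S}$ contains infinitely many pairwise disjoint elements. -}

module Defs where

open import Data.Nat using (ℕ; zero; suc; _<_; _^_; _/_; _%_)
open import Data.Nat.Properties using ()
open import Data.Fin using (Fin)
open import Data.Vec using (Vec; []; _∷_; lookup)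
open import Data.Bool using (Bool; true; false)
open import Data.List using (List)
open import Data.List.Membership.Propositional using (_∈_)
open import Data.Product using (Σ; ∃; _×_; _,_)
open import Relation.Binary.PropositionalEquality using (_≡_; _≢_)
open import Relation.Nullary using (¬_)
open import Function.Bundles using (_⇔_)

data PR : ℕ → Set where
  zeroF : ∀ {n} → PR n
  succF : PR 1
  proj  : ∀ {n} → Fin n → PR n
  comp  : ∀ {m n} → PR m → Vec (PR n) m → PR n
  prec  : ∀ {n} → PR n → PR (suc (suc n)) → PR (suc n)
  mu    : ∀ {n} → PR (suc n) → PR n

mutual
  data Eval : ∀ {n} → PR n → Vec ℕ n → ℕ → Set where
    ev-zero : ∀ {n} {xs : Vec ℕ n} → Eval zeroF xs 0
    ev-succ : ∀ {x} → Eval succF (x ∷ []) (suc x)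
    ev-proj : ∀ {n} {xs : Vec ℕ n} (i : Fin n) → Eval (proj i) xs (lookup xs i)
    ev-comp : ∀ {m n} {f : PR m} {gs : Vec (PR n) m} {xs : Vec ℕ n}
                {ys : Vec ℕ m} {z : ℕ} →
              EvalVec gs xs ys → Eval f ys z → Eval (comp f gs) xs z
    ev-prec0 : ∀ {n} {f : PR n} {g : PR (suc (suc n))} {xs : Vec ℕ n} {y} →
               Eval f xs y → Eval (prec f g) (0 ∷ xs) y
    ev-precS : ∀ {n} {f : PR n} {g : PR (suc (suc n))} {xs : Vec ℕ n} {k r y} →
               Eval (prec f g) (k ∷ xs) r → Eval g (k ∷ r ∷ xs) y →
               Eval (prec f g) (suc k ∷ xs) y
    ev-mu : ∀ {n} {f : PR (suc n)} {xs : Vec ℕ n} {y} →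
            Eval f (y ∷ xs) 0 →
            (∀ z → z < y → ∃ λ v → Eval f (z ∷ xs) (suc v)) →
            Eval (mu f) xs y

  data EvalVec : ∀ {m n} → Vec (PR n) m → Vec ℕ n → Vec ℕ m → Set where
    evv-[] : ∀ {n} {xs : Vec ℕ n} → EvalVec [] xs []
    evv-∷  : ∀ {m n} {g : PR n} {gs : Vec (PR n) m} {xs : Vec ℕ n} {y ys} →
             Eval g xs y → EvalVec gs xs ys → EvalVec (g ∷ gs) xs (y ∷ ys)

boolToℕ : Bool → ℕ
boolToℕ false = 0
boolToℕ true  = 1

Computable : (ℕ → Bool) → Set
Computable c = Σ (PR 1) λ e → ∀ n → Eval e (n ∷ []) (boolToℕ (c n))

CE : (ℕ → Set) → Set
CE S = Σ (PR 1) λ e → ∀ n → S n ⇔ (∃ λ v → Eval e (n ∷ []) v)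

-- P_fin(ℕ) identified with ℕ via the computable bijection
-- n ↦ { i | the i-th binary digit of n is 1 }.

FinSet : Set
FinSet = ℕ

bit : ℕ → ℕ → ℕ
bit zero    s = s % 2
bit (suc i) s = bit i (s / 2)

_∈ₛ_ : ℕ → FinSet → Set
i ∈ₛ s = bit i s ≡ 1

Disjoint : FinSet → FinSet → Set
Disjoint a b = ∀ i → i ∈ₛ a → ¬ (i ∈ₛ b)

NonEmpty : FinSet → Set
NonEmpty a = ∃ λ i → i ∈ₛ a

-- 𝒮 generates an IP set: 𝒮 contains infinitely many pairwise disjoint
-- elements (given as an injective sequence of pairwise disjoint members).
GeneratesIP : (FinSet → Set) → Set
GeneratesIP 𝒮 = Σ (ℕ → FinSet) λ f →
  (∀ k → 𝒮 (f k)) ×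
  (∀ j k → j ≢ k → f j ≢ f k) ×
  (∀ j k → j ≢ k → Disjoint (f j) (f k))

IsUnionOf : FinSet → List FinSet → Set
IsUnionOf x L = ∀ i → i ∈ₛ x ⇔ (∃ λ s → s ∈ L × i ∈ₛ s)

NU : (FinSet → Set) → FinSet → Set
NU 𝒮 x = NonEmpty x × (∃ λ (L : List FinSet) →
  (∀ s → s ∈ L → 𝒮 s) × IsUnionOf x L)

ConstantOn : (FinSet → Bool) → (FinSet → Set) → Set
ConstantOn c A = ∀ x y → A x → A y → c x ≡ c y

-- At stage y each program e < y in turn claims the two least unclaimed numbers p₁ < p₂ that are
-- maxima of nonempty sets a < y accepted by e within y steps, and the pair (p₂ , y) is marked.
-- A finite set is coloured by the parity of its marked consecutive pairs.  If 𝒮 = dom e has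
-- infinitely many disjoint members, pick one, b, whose least element y is so large that by stage y
-- the program e has accepted 2e + 3 members below y; then e acts at stage y and claims the maxima
-- of two sets a₁ , a₂ ∈ 𝒮.  Joining aᵢ to b adds the single consecutive pair (pᵢ , y), unmarked for
-- i = 1 and marked for i = 2, so constancy of the colour on NU(𝒮) would give the colour of b both
-- parities.  Acceptance within y steps is decided by bounded search for a certificate: a list of
-- evaluation facts, each following from earlier ones by one rule of the big-step semantics.
-- Every ingredient is a bounded search or primitive recursion, so the colouring is computable.

module Submission where

open import Defs
open import Data.Bool using (Bool)
open import Data.Product using (Σ; _×_)
open import Relation.Nullary using (¬_)

module Representable where

  open import Data.Nat
  open import Data.Nat.Properties
  open import Data.Bool using (Bool; true; false; _∧_; _∨_; not; if_then_else_)
  open import Data.Fin using (Fin; zero; suc)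
  open import Data.Vec using (Vec; []; _∷_; lookup; map; tabulate; allFin; head; tail)
  open import Data.Vec.Properties using (tabulate∘lookup; tabulate-∘)
  open import Data.Product using (Σ; _,_)
  open import Relation.Binary.PropositionalEquality
  open import Function using (id)

  Rep : ∀ n → (Vec ℕ n → ℕ) → Set
  Rep n f = Σ (PR n) λ p → ∀ xs → Eval p xs (f xs)

  RepB : ∀ n → (Vec ℕ n → Bool) → Set
  RepB n P = Rep n (λ xs → boolToℕ (P xs))

  rep-ext : ∀ {n} {f g : Vec ℕ n → ℕ} → (∀ xs → f xs ≡ g xs) → Rep n f → Rep n g
  rep-ext f≗g (p , ev) = p , λ xs → subst (Eval p xs) (f≗g xs) (ev xs)

  data RepVec (n : ℕ) : (m : ℕ) → (Vec ℕ n → Vec ℕ m) → Set where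
    []  : RepVec n 0 (λ _ → [])
    _∷_ : ∀ {m g gs} → Rep n g → RepVec n m gs → RepVec n (suc m) (λ xs → g xs ∷ gs xs)

  programs : ∀ {n m gs} → RepVec n m gs → Vec (PR n) m
  programs []             = []
  programs ((p , _) ∷ rs) = p ∷ programs rs

  eval-programs : ∀ {n m gs} (rs : RepVec n m gs) xs → EvalVec (programs rs) xs (gs xs)
  eval-programs []              xs = evv-[]
  eval-programs ((p , ev) ∷ rs) xs = evv-∷ (ev xs) (eval-programs rs xs)

  rep-comp : ∀ {n m f gs} → Rep m f → RepVec n m gs → Rep n (λ xs → f (gs xs))
  rep-comp (p , ev) rs = comp p (programs rs) , λ xs → ev-comp (eval-programs rs xs) (ev _)

  rep-proj : ∀ {n} (i : Fin n) → Rep n (λ xs → lookup xs i)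
  rep-proj i = proj i , λ _ → ev-proj i

  rep-zero : ∀ {n} → Rep n (λ _ → 0)
  rep-zero = zeroF , λ _ → ev-zero

  rep-succ : Rep 1 (λ xs → suc (lookup xs zero))
  rep-succ = succF , λ { (x ∷ []) → ev-succ }

  natrec : ∀ {n} → (Vec ℕ n → ℕ) → (Vec ℕ (2 + n) → ℕ) → Vec ℕ (suc n) → ℕ
  natrec f g (zero  ∷ xs) = f xs
  natrec f g (suc k ∷ xs) = g (k ∷ natrec f g (k ∷ xs) ∷ xs)

  rep-natrec : ∀ {n f g} → Rep n f → Rep (2 + n) g → Rep (suc n) (natrec f g)
  rep-natrec {f = f} {g} (p , evp) (q , evq) = prec p q , go
    where
    go : ∀ xs → Eval (prec p q) xs (natrec f g xs)
    go (zero  ∷ xs) = ev-prec0 (evp xs)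
    go (suc k ∷ xs) = ev-precS (go (k ∷ xs)) (evq _)

  projections : ∀ {n m} (ρ : Vec (Fin n) m) → RepVec n m (λ xs → map (lookup xs) ρ)
  projections []      = []
  projections (i ∷ ρ) = rep-proj i ∷ projections ρ

  map-lookup-tabulate : ∀ {n m} (xs : Vec ℕ n) (ρ : Fin m → Fin n) →
                        map (lookup xs) (tabulate ρ) ≡ tabulate (λ i → lookup xs (ρ i))
  map-lookup-tabulate xs ρ = sym (tabulate-∘ (lookup xs) ρ)

  rep-let : ∀ {n f a} → Rep (suc n) f → Rep n a → Rep n (λ xs → f (a xs ∷ xs))
  rep-let {n} {f} {a} rf ra =
    rep-ext (λ xs → cong (λ v → f (a xs ∷ v)) (trans (map-lookup-tabulate xs id) (tabulate∘lookup xs)))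
            (rep-comp rf (ra ∷ projections (allFin n)))

  rep-skip₁ : ∀ {n f} → Rep (suc n) f → Rep (2 + n) (λ xs → f (head xs ∷ tail (tail xs)))
  rep-skip₁ {n} {f} rf =
    rep-ext (λ { (k ∷ r ∷ xs) → cong (λ v → f (k ∷ v))
                   (trans (map-lookup-tabulate (k ∷ r ∷ xs) (λ i → suc (suc i))) (tabulate∘lookup xs)) })
            (rep-comp rf (projections (zero ∷ tabulate (λ i → suc (suc i)))))

  rep-comp₁ : ∀ {n f g} → Rep 1 f → Rep n g → Rep n (λ xs → f (g xs ∷ []))
  rep-comp₁ rf rg = rep-comp rf (rg ∷ [])

  rep-comp₂ : ∀ {n f g h} → Rep 2 f → Rep n g → Rep n h → Rep n (λ xs → f (g xs ∷ h xs ∷ []))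
  rep-comp₂ rf rg rh = rep-comp rf (rg ∷ rh ∷ [])

  rep-comp₃ : ∀ {n f g h k} → Rep 3 f → Rep n g → Rep n h → Rep n k →
              Rep n (λ xs → f (g xs ∷ h xs ∷ k xs ∷ []))
  rep-comp₃ rf rg rh rk = rep-comp rf (rg ∷ rh ∷ rk ∷ [])

  rep-comp₄ : ∀ {n f g h k l} → Rep 4 f → Rep n g → Rep n h → Rep n k → Rep n l →
              Rep n (λ xs → f (g xs ∷ h xs ∷ k xs ∷ l xs ∷ []))
  rep-comp₄ rf rg rh rk rl = rep-comp rf (rg ∷ rh ∷ rk ∷ rl ∷ [])

  #0 : ∀ {n} → Rep (1 + n) (λ xs → lookup xs zero)
  #0 = rep-proj zero
  #1 : ∀ {n} → Rep (2 + n) (λ xs → lookup xs (suc zero))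
  #1 = rep-proj (suc zero)
  #2 : ∀ {n} → Rep (3 + n) (λ xs → lookup xs (suc (suc zero)))
  #2 = rep-proj (suc (suc zero))
  #3 : ∀ {n} → Rep (4 + n) (λ xs → lookup xs (suc (suc (suc zero))))
  #3 = rep-proj (suc (suc (suc zero)))
  #4 : ∀ {n} → Rep (5 + n) (λ xs → lookup xs (suc (suc (suc (suc zero)))))
  #4 = rep-proj (suc (suc (suc (suc zero))))

  rep-const : ∀ {n} k → Rep n (λ _ → k)
  rep-const zero    = rep-zero
  rep-const (suc k) = rep-comp₁ rep-succ (rep-const k)

  rep-suc : ∀ {n f} → Rep n f → Rep n (λ xs → suc (f xs))
  rep-suc = rep-comp₁ rep-succ

  rep-+ : ∀ {n f g} → Rep n f → Rep n g → Rep n (λ xs → f xs + g xs)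
  rep-+ = rep-comp₂ rep-+₀
    where
    natrec-+ : ∀ x y → natrec (λ v → lookup v zero) (λ v → suc (lookup v (suc zero))) (x ∷ y ∷ []) ≡ x + y
    natrec-+ zero    y = refl
    natrec-+ (suc x) y = cong suc (natrec-+ x y)
    rep-+₀ : Rep 2 (λ v → lookup v zero + lookup v (suc zero))
    rep-+₀ = rep-ext (λ { (x ∷ y ∷ []) → natrec-+ x y }) (rep-natrec #0 (rep-suc #1))

  rep-pred : ∀ {n f} → Rep n f → Rep n (λ xs → pred (f xs))
  rep-pred = rep-comp₁ rep-pred₀
    where
    rep-pred₀ : Rep 1 (λ v → pred (lookup v zero))
    rep-pred₀ = rep-ext (λ { (zero ∷ []) → refl ; (suc x ∷ []) → refl }) (rep-natrec rep-zero #0)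

  rep-∸ : ∀ {n f g} → Rep n f → Rep n g → Rep n (λ xs → f xs ∸ g xs)
  rep-∸ rf rg = rep-comp₂ rep-∸₀ rg rf
    where
    natrec-∸ : ∀ y x → natrec (λ v → lookup v zero) (λ v → pred (lookup v (suc zero))) (y ∷ x ∷ []) ≡ x ∸ y
    natrec-∸ zero    x = refl
    natrec-∸ (suc y) x = trans (cong pred (natrec-∸ y x)) (pred[m∸n]≡m∸[1+n] x y)
    rep-∸₀ : Rep 2 (λ v → lookup v (suc zero) ∸ lookup v zero)
    rep-∸₀ = rep-ext (λ { (y ∷ x ∷ []) → natrec-∸ y x }) (rep-natrec #0 (rep-pred #1))

  rep-if : ∀ {n P f g} → RepB n P → Rep n f → Rep n g → Rep n (λ xs → if P xs then f xs else g xs)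
  rep-if {P = P} rp rf rg = rep-ext (λ xs → natrec-if (P xs) _ _) (rep-comp₃ rep-cond rp rf rg)
    where
    rep-cond : Rep 3 (natrec (λ v → lookup v (suc zero)) (λ v → lookup v (suc (suc zero))))
    rep-cond = rep-natrec #1 #2
    natrec-if : ∀ b x y → natrec (λ v → lookup v (suc zero)) (λ v → lookup v (suc (suc zero)))
                                 (boolToℕ b ∷ x ∷ y ∷ [])
                          ≡ (if b then x else y)
    natrec-if false x y = refl
    natrec-if true  x y = refl

  repB-const : ∀ {n} b → RepB n (λ _ → b)
  repB-const b = rep-const (boolToℕ b)

  repB-∧ : ∀ {n P Q} → RepB n P → RepB n Q → RepB n (λ xs → P xs ∧ Q xs)
  repB-∧ {P = P} {Q} rp rq = rep-ext (λ xs → if-∧ (P xs) (Q xs)) (rep-if rp rq (repB-const false))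
    where
    if-∧ : ∀ a b → (if a then boolToℕ b else 0) ≡ boolToℕ (a ∧ b)
    if-∧ false b = refl
    if-∧ true  b = refl

  repB-∨ : ∀ {n P Q} → RepB n P → RepB n Q → RepB n (λ xs → P xs ∨ Q xs)
  repB-∨ {P = P} {Q} rp rq = rep-ext (λ xs → if-∨ (P xs) (Q xs)) (rep-if rp (repB-const true) rq)
    where
    if-∨ : ∀ a b → (if a then 1 else boolToℕ b) ≡ boolToℕ (a ∨ b)
    if-∨ false b = refl
    if-∨ true  b = refl

  repB-not : ∀ {n P} → RepB n P → RepB n (λ xs → not (P xs))
  repB-not {P = P} rp = rep-ext (λ xs → if-not (P xs)) (rep-if rp (repB-const false) (repB-const true))
    where
    if-not : ∀ a → (if a then 0 else 1) ≡ boolToℕ (not a)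
    if-not false = refl
    if-not true  = refl

  isZero : ℕ → Bool
  isZero zero    = true
  isZero (suc _) = false

  repB-isZero : ∀ {n f} → Rep n f → RepB n (λ xs → isZero (f xs))
  repB-isZero = rep-comp₁ repB-isZero₀
    where
    repB-isZero₀ : RepB 1 (λ v → isZero (lookup v zero))
    repB-isZero₀ = rep-ext (λ { (zero ∷ []) → refl ; (suc x ∷ []) → refl }) (rep-natrec (rep-const 1) rep-zero)

  repB-≡ᵇ : ∀ {n f g} → Rep n f → Rep n g → RepB n (λ xs → f xs ≡ᵇ g xs)
  repB-≡ᵇ {f = f} {g} rf rg =
    rep-ext (λ xs → cong boolToℕ (isZero-dist (f xs) (g xs)))
            (repB-isZero (rep-+ (rep-∸ rf rg) (rep-∸ rg rf)))
    where
    isZero-dist : ∀ x y → isZero ((x ∸ y) + (y ∸ x)) ≡ (x ≡ᵇ y)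
    isZero-dist zero    zero    = refl
    isZero-dist zero    (suc y) = refl
    isZero-dist (suc x) zero    = refl
    isZero-dist (suc x) (suc y) = isZero-dist x y

  repB-<ᵇ : ∀ {n f g} → Rep n f → Rep n g → RepB n (λ xs → f xs <ᵇ g xs)
  repB-<ᵇ {f = f} {g} rf rg =
    rep-ext (λ xs → cong boolToℕ (not-isZero-∸ (f xs) (g xs))) (repB-not (repB-isZero (rep-∸ rg rf)))
    where
    not-isZero-∸ : ∀ x y → not (isZero (y ∸ x)) ≡ (x <ᵇ y)
    not-isZero-∸ zero    zero    = refl
    not-isZero-∸ zero    (suc y) = refl
    not-isZero-∸ (suc x) zero    = refl
    not-isZero-∸ (suc x) (suc y) = not-isZero-∸ x y

module BoundedSearch where

  open Representable
  open import Data.Nat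
  open import Data.Nat.Properties
  open import Data.Bool using (Bool; true; false; _∧_; _∨_; not; if_then_else_; T)
  open import Data.Bool.Properties using (T-∨; T-∧; T-≡)
  open import Data.Fin using (zero; suc)
  open import Data.Vec using (Vec; _∷_; lookup; head; tail)
  open import Data.Product using (∃; _×_; _,_)
  open import Data.Sum using (_⊎_; inj₁; inj₂)
  open import Data.Empty using (⊥-elim)
  open import Relation.Nullary using (¬_)
  open import Relation.Binary.PropositionalEquality
  open import Relation.Binary.Definitions using (tri<; tri≈; tri>)
  open import Function.Bundles using (Equivalence)
  open import Data.Nat.Tactic.RingSolver using (solve-∀)

  T⇒≡ : ∀ {m n} → T (m ≡ᵇ n) → m ≡ n
  T⇒≡ {m} {n} = ≡ᵇ⇒≡ m n

  ≡⇒T : ∀ {m n} → m ≡ n → T (m ≡ᵇ n)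
  ≡⇒T {m} {n} = ≡⇒≡ᵇ m n

  T⇒< : ∀ {m n} → T (m <ᵇ n) → m < n
  T⇒< {m} {n} = <ᵇ⇒< m n

  <⇒T : ∀ {m n} → m < n → T (m <ᵇ n)
  <⇒T = <⇒<ᵇ

  <⇒<ᵇ-true : ∀ {m n} → m < n → (m <ᵇ n) ≡ true
  <⇒<ᵇ-true m<n = Equivalence.to T-≡ (<⇒T m<n)

  ≡ᵇ-refl : ∀ n → (n ≡ᵇ n) ≡ true
  ≡ᵇ-refl zero    = refl
  ≡ᵇ-refl (suc n) = ≡ᵇ-refl n

  ≢⇒≡ᵇ-false : ∀ {m n} → m ≢ n → (m ≡ᵇ n) ≡ false
  ≢⇒≡ᵇ-false {m} {n} m≢n with m ≡ᵇ n in eq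
  ... | true  = ⊥-elim (m≢n (T⇒≡ (subst T (sym eq) _)))
  ... | false = refl

  ∧-fst : ∀ a {b} → T (a ∧ b) → T a
  ∧-fst true _ = _

  ∧-snd : ∀ a {b} → T (a ∧ b) → T b
  ∧-snd true t = t

  ∧-split : ∀ a {b} → T (a ∧ b) → T a × T b
  ∧-split true t = _ , t

  ∧-intro : ∀ a {b} → T a → T b → T (a ∧ b)
  ∧-intro true _ t = t

  ∨-inl : ∀ a {b} → T a → T (a ∨ b)
  ∨-inl true _ = _

  ∨-inr : ∀ a {b} → T b → T (a ∨ b)
  ∨-inr true  _ = _
  ∨-inr false t = t

  ¬T⇒T-not : ∀ {b} → ¬ T b → T (not b)
  ¬T⇒T-not {false} _ = _
  ¬T⇒T-not {true}  ¬t = ¬t _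

  T-not⇒¬T : ∀ {b} → T (not b) → ¬ T b
  T-not⇒¬T {false} _ ()

  T⇒≡true : ∀ {b} → T b → b ≡ true
  T⇒≡true {true} _ = refl

  ¬T⇒≡false : ∀ {b} → ¬ T b → b ≡ false
  ¬T⇒≡false {false} _ = refl
  ¬T⇒≡false {true}  ¬t = ⊥-elim (¬t _)

  ∨-elim : ∀ a {b} → T (a ∨ b) → T a ⊎ T b
  ∨-elim true  _ = inj₁ _
  ∨-elim false t = inj₂ t

  any< : ℕ → (ℕ → Bool) → Bool
  any< zero    P = false
  any< (suc k) P = any< k P ∨ P k

  all< : ℕ → (ℕ → Bool) → Bool
  all< zero    P = true
  all< (suc k) P = all< k P ∧ P k

  sum< : ℕ → (ℕ → ℕ) → ℕ
  sum< zero    f = 0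
  sum< (suc k) f = sum< k f + f k

  -- The least i < k with P i, and k if there is none.
  min< : ℕ → (ℕ → Bool) → ℕ
  min< zero    P = 0
  min< (suc k) P = if any< k P then min< k P else (if P k then k else suc k)

  any<-intro : ∀ k P i → i < k → T (P i) → T (any< k P)
  any<-intro (suc k) P i (s≤s i≤k) t with m≤n⇒m<n∨m≡n i≤k
  ... | inj₁ i<k  = Equivalence.from T-∨ (inj₁ (any<-intro k P i i<k t))
  ... | inj₂ refl = Equivalence.from T-∨ (inj₂ t)

  any<-elim : ∀ k P → T (any< k P) → ∃ λ i → i < k × T (P i)
  any<-elim (suc k) P t with Equivalence.to T-∨ t
  ... | inj₁ t′ = let (i , i<k , pi) = any<-elim k P t′ in i , m<n⇒m<1+n i<k , pi
  ... | inj₂ t′ = k , ≤-refl , t′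

  all<-intro : ∀ k P → (∀ i → i < k → T (P i)) → T (all< k P)
  all<-intro zero    P h = _
  all<-intro (suc k) P h =
    Equivalence.from T-∧ (all<-intro k P (λ i i<k → h i (m<n⇒m<1+n i<k)) , h k ≤-refl)

  all<-elim : ∀ k P → T (all< k P) → ∀ i → i < k → T (P i)
  all<-elim (suc k) P t i (s≤s i≤k) with Equivalence.to T-∧ t | m≤n⇒m<n∨m≡n i≤k
  ... | (t′ , _) | inj₁ i<k  = all<-elim k P t′ i i<k
  ... | (_ , pk) | inj₂ refl = pk

  min<-none : ∀ k P → ¬ T (any< k P) → min< k P ≡ k
  min<-none zero    P h = refl
  min<-none (suc k) P h with any< k P | P k
  ... | true  | _     = ⊥-elim (h _)
  ... | false | true  = ⊥-elim (h _)
  ... | false | false = refl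

  min<-spec : ∀ k P → T (any< k P) →
              min< k P < k × T (P (min< k P)) × (∀ j → j < min< k P → ¬ T (P j))
  min<-spec (suc k) P t with any< k P in eq
  ... | true = let (m<k , pm , least) = min<-spec k P (subst T (sym eq) _) in m<n⇒m<1+n m<k , pm , least
  ... | false with P k in eq′
  ...   | true  = ≤-refl , subst T (sym eq′) _ , λ j j<k pj → subst T eq (any<-intro k P j j<k pj)
  ...   | false = ⊥-elim t

  min<-unique : ∀ k P i → i < k → T (P i) → (∀ j → j < i → ¬ T (P j)) → min< k P ≡ i
  min<-unique k P i i<k pi least with min<-spec k P (any<-intro k P i i<k pi)
  ... | (_ , pm , least′) with <-cmp (min< k P) i
  ...   | tri< m<i _ _ = ⊥-elim (least _ m<i pm)
  ...   | tri≈ _ m≡i _ = m≡i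
  ...   | tri> _ _ i<m = ⊥-elim (least′ i i<m pi)

  sum<-≤ : ∀ k (f : ℕ → ℕ) i → i < k → f i ≤ sum< k f
  sum<-≤ (suc k) f i (s≤s i≤k) with m≤n⇒m<n∨m≡n i≤k
  ... | inj₁ i<k  = ≤-trans (sum<-≤ k f i i<k) (m≤m+n _ _)
  ... | inj₂ refl = m≤n+m _ _

  fold< : (ℕ → ℕ → ℕ) → ℕ → ℕ → (ℕ → ℕ) → ℕ
  fold< h z zero    f = z
  fold< h z (suc k) f = h (fold< h z k f) (f k)

  rep-fold< : ∀ {n h f a} z → Rep 2 (λ v → h (lookup v zero) (lookup v (suc zero))) → Rep n a →
              Rep (suc n) f → Rep n (λ xs → fold< h z (a xs) (λ i → f (i ∷ xs)))
  rep-fold< {n} {h} {f} z rh ra rf =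
    rep-let {f = λ ys → fold< h z (head ys) (λ i → f (i ∷ tail ys))}
            (rep-ext (λ { (k ∷ xs) → natrec-fold k xs })
                     (rep-natrec (rep-const z) (rep-comp₂ rh #1 (rep-skip₁ rf)))) ra
    where
    natrec-fold : ∀ k xs →
      natrec (λ _ → z) (λ v → h (lookup v (suc zero)) (f (head v ∷ tail (tail v)))) (k ∷ xs)
      ≡ fold< h z k (λ i → f (i ∷ xs))
    natrec-fold zero    xs = refl
    natrec-fold (suc k) xs = cong (λ r → h r (f (k ∷ xs))) (natrec-fold k xs)

  private
    boolToℕ-≡ᵇ-1 : ∀ b → (boolToℕ b ≡ᵇ 1) ≡ b
    boolToℕ-≡ᵇ-1 false = refl
    boolToℕ-≡ᵇ-1 true  = refl

    repB-∨₀ : RepB 2 (λ v → (lookup v zero ≡ᵇ 1) ∨ (lookup v (suc zero) ≡ᵇ 1))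
    repB-∨₀ = repB-∨ (repB-≡ᵇ #0 (rep-const 1)) (repB-≡ᵇ #1 (rep-const 1))

    repB-∧₀ : RepB 2 (λ v → (lookup v zero ≡ᵇ 1) ∧ (lookup v (suc zero) ≡ᵇ 1))
    repB-∧₀ = repB-∧ (repB-≡ᵇ #0 (rep-const 1)) (repB-≡ᵇ #1 (rep-const 1))

  repB-any< : ∀ {n P a} → Rep n a → RepB (suc n) P → RepB n (λ xs → any< (a xs) (λ i → P (i ∷ xs)))
  repB-any< {P = P} {a} ra rp =
    rep-ext (λ xs → fold-any (λ i → P (i ∷ xs)) (a xs))
            (rep-fold< {h = λ x y → boolToℕ ((x ≡ᵇ 1) ∨ (y ≡ᵇ 1))} 0 repB-∨₀ ra rp)
    where
    fold-any : ∀ Q k → fold< (λ x y → boolToℕ ((x ≡ᵇ 1) ∨ (y ≡ᵇ 1))) 0 k (λ i → boolToℕ (Q i))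
                       ≡ boolToℕ (any< k Q)
    fold-any Q zero = refl
    fold-any Q (suc k) rewrite fold-any Q k | boolToℕ-≡ᵇ-1 (any< k Q) | boolToℕ-≡ᵇ-1 (Q k) = refl

  repB-all< : ∀ {n P a} → Rep n a → RepB (suc n) P → RepB n (λ xs → all< (a xs) (λ i → P (i ∷ xs)))
  repB-all< {P = P} {a} ra rp =
    rep-ext (λ xs → fold-all (λ i → P (i ∷ xs)) (a xs))
            (rep-fold< {h = λ x y → boolToℕ ((x ≡ᵇ 1) ∧ (y ≡ᵇ 1))} 1 repB-∧₀ ra rp)
    where
    fold-all : ∀ Q k → fold< (λ x y → boolToℕ ((x ≡ᵇ 1) ∧ (y ≡ᵇ 1))) 1 k (λ i → boolToℕ (Q i))
                       ≡ boolToℕ (all< k Q)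
    fold-all Q zero = refl
    fold-all Q (suc k) rewrite fold-all Q k | boolToℕ-≡ᵇ-1 (all< k Q) | boolToℕ-≡ᵇ-1 (Q k) = refl

  rep-sum< : ∀ {n f a} → Rep n a → Rep (suc n) f → Rep n (λ xs → sum< (a xs) (λ i → f (i ∷ xs)))
  rep-sum< {f = f} {a} ra rf =
    rep-ext (λ xs → fold-sum (λ i → f (i ∷ xs)) (a xs)) (rep-fold< {h = _+_} 0 (rep-+ #0 #1) ra rf)
    where
    fold-sum : ∀ g k → fold< _+_ 0 k g ≡ sum< k g
    fold-sum g zero    = refl
    fold-sum g (suc k) = cong (_+ g k) (fold-sum g k)

  rep-min< : ∀ {n P a} → Rep n a → RepB (suc n) P → Rep n (λ xs → min< (a xs) (λ i → P (i ∷ xs)))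
  rep-min< {n} {P} ra rp =
    rep-let {f = λ ys → min< (head ys) (λ i → P (i ∷ tail ys))} (rep-ext (λ { (k ∷ xs) → natrec-min k xs }) rep-min) ra
    where
    step : Vec ℕ (2 + n) → ℕ
    step v = if any< (head v) (λ i → P (i ∷ tail (tail v))) then lookup v (suc zero)
             else (if P (head v ∷ tail (tail v)) then lookup v zero else suc (lookup v zero))
    rep-min : Rep (suc n) (natrec (λ _ → 0) step)
    rep-min = rep-natrec rep-zero
      (rep-if (rep-skip₁ (repB-any< #0 (rep-skip₁ rp))) #1 (rep-if (rep-skip₁ rp) #0 (rep-suc #0)))
    natrec-min : ∀ k xs → natrec (λ _ → 0) step (k ∷ xs) ≡ min< k (λ i → P (i ∷ xs))
    natrec-min zero    xs = refl
    natrec-min (suc k) xs rewrite natrec-min k xs = refl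

  sum<-cong : ∀ N f g → (∀ i → i < N → f i ≡ g i) → sum< N f ≡ sum< N g
  sum<-cong zero    f g h = refl
  sum<-cong (suc N) f g h = cong₂ _+_ (sum<-cong N f g (λ i i< → h i (m<n⇒m<1+n i<))) (h N ≤-refl)

  sum<-+ : ∀ N f g → sum< N (λ i → f i + g i) ≡ sum< N f + sum< N g
  sum<-+ zero    f g = refl
  sum<-+ (suc N) f g rewrite sum<-+ N f g = +-interchange (sum< N f) (sum< N g) (f N) (g N)
    where
    +-interchange : ∀ a b c d → a + b + (c + d) ≡ a + c + (b + d)
    +-interchange = solve-∀

  sum<-zero : ∀ N f → (∀ i → i < N → f i ≡ 0) → sum< N f ≡ 0
  sum<-zero zero    f h = refl
  sum<-zero (suc N) f h rewrite sum<-zero N f (λ i i< → h i (m<n⇒m<1+n i<)) = h N ≤-refl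

  if-false : ∀ {A : Set} {b} {x y : A} → b ≡ false → (if b then x else y) ≡ y
  if-false refl = refl

  sum<-point : ∀ N y v → y < N → sum< N (λ q → if q ≡ᵇ y then v else 0) ≡ v
  sum<-point (suc N) y v (s≤s y≤N) with m≤n⇒m<n∨m≡n y≤N
  ... | inj₁ y<N rewrite sum<-point N y v y<N | ≢⇒≡ᵇ-false (>⇒≢ y<N) = +-identityʳ v
  ... | inj₂ refl
    rewrite sum<-zero N (λ q → if q ≡ᵇ N then v else 0) (λ i i<N → if-false (≢⇒≡ᵇ-false (<⇒≢ i<N)))
                        | ≡ᵇ-refl N = refl

  sum<-vanish : ∀ M N f → (∀ i → M ≤ i → f i ≡ 0) → M ≤ N → sum< N f ≡ sum< M f
  sum<-vanish M zero    f h z≤n = refl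
  sum<-vanish M (suc N) f h M≤ with m≤n⇒m<n∨m≡n M≤
  ... | inj₂ refl = refl
  ... | inj₁ M<1+N rewrite h N (≤-pred M<1+N) = trans (+-identityʳ _) (sum<-vanish M N f h (≤-pred M<1+N))

module Pairing where

  open Representable
  open BoundedSearch
  open import Data.Nat
  open import Data.Nat.Properties
  open import Data.Bool using (T)
  open import Data.Fin using (zero; suc)
  open import Data.Vec using ([]; _∷_; lookup)
  open import Data.Product using (_×_; _,_)
  open import Relation.Nullary using (¬_)
  open import Relation.Binary.PropositionalEquality

  triangle : ℕ → ℕ
  triangle zero    = 0
  triangle (suc w) = triangle w + suc w

  triangle-mono : ∀ {a b} → a ≤ b → triangle a ≤ triangle b
  triangle-mono {b = zero}      z≤n       = z≤n
  triangle-mono {zero}  {suc b} _         = z≤n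
  triangle-mono {suc a} {suc b} (s≤s a≤b) = +-mono-≤ (triangle-mono a≤b) (s≤s a≤b)

  n≤triangle : ∀ n → n ≤ triangle n
  n≤triangle zero    = z≤n
  n≤triangle (suc n) = m≤n+m (suc n) (triangle n)

  -- Kept abstract so that codes are never unfolded during type checking.
  abstract
    pair : ℕ → ℕ → ℕ
    pair x y = triangle (x + y) + y

    -- The w with triangle w ≤ z < triangle (1 + w).
    level : ℕ → ℕ
    level z = min< (suc z) (λ w → z <ᵇ triangle (suc w))

    unpair₂ : ℕ → ℕ
    unpair₂ z = z ∸ triangle (level z)

    unpair₁ : ℕ → ℕ
    unpair₁ z = level z ∸ unpair₂ z

    level-spec : ∀ z → triangle (level z) ≤ z × z < triangle (suc (level z))
    level-spec z
      with min<-spec (suc z) (λ w → z <ᵇ triangle (suc w))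
             (any<-intro (suc z) _ z ≤-refl (<⇒T (<-≤-trans (n<1+n z) (n≤triangle (suc z)))))
    ... | (_ , above , least) = below (level z) least , T⇒< above
      where
      below : ∀ d → (∀ j → j < d → ¬ T (z <ᵇ triangle (suc j))) → triangle d ≤ z
      below zero    _     = z≤n
      below (suc d) least = ≮⇒≥ (λ z<t → least d ≤-refl (<⇒T z<t))

    level-pair : ∀ x y → level (pair x y) ≡ x + y
    level-pair x y =
      min<-unique (suc (pair x y)) _ (x + y) (s≤s (≤-trans (n≤triangle (x + y)) (m≤m+n _ y)))
        (<⇒T (+-monoʳ-< (triangle (x + y)) (s≤s (m≤n+m y x))))
        (λ j j<x+y t → <⇒≱ (T⇒< t) (≤-trans (triangle-mono j<x+y) (m≤m+n _ y)))

    unpair₂-pair : ∀ x y → unpair₂ (pair x y) ≡ y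
    unpair₂-pair x y rewrite level-pair x y = m+n∸m≡n (triangle (x + y)) y

    unpair₁-pair : ∀ x y → unpair₁ (pair x y) ≡ x
    unpair₁-pair x y rewrite unpair₂-pair x y | level-pair x y = m+n∸n≡m x y

    pair-unpair : ∀ z → pair (unpair₁ z) (unpair₂ z) ≡ z
    pair-unpair z with level-spec z
    ... | (lo , hi) = trans (cong (λ w → triangle w + unpair₂ z) unpair-sum) (m+[n∸m]≡n lo)
      where
      unpair₂≤level : unpair₂ z ≤ level z
      unpair₂≤level = +-cancelˡ-≤ (triangle (level z)) _ _
        (≤-trans (≤-reflexive (m+[n∸m]≡n lo))
                 (≤-pred (≤-trans hi (≤-reflexive (+-suc (triangle (level z)) (level z))))))
      unpair-sum : unpair₁ z + unpair₂ z ≡ level z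
      unpair-sum = m∸n+n≡m unpair₂≤level

    unpair₂-≤ : ∀ z → unpair₂ z ≤ z
    unpair₂-≤ z = m∸n≤m z (triangle (level z))

    ≤-pair₂ : ∀ x y → y ≤ pair x y
    ≤-pair₂ x y = m≤n+m y _

    unpair-0 : unpair₁ 0 ≡ 0 × unpair₂ 0 ≡ 0
    unpair-0 = refl , refl

    rep-triangle : Rep 1 (λ v → triangle (lookup v zero))
    rep-triangle = rep-ext (λ { (k ∷ []) → natrec-triangle k }) (rep-natrec rep-zero (rep-+ #1 (rep-suc #0)))
      where
      natrec-triangle : ∀ k → natrec (λ _ → 0) (λ v → lookup v (suc zero) + suc (lookup v zero)) (k ∷ [])
                              ≡ triangle k
      natrec-triangle zero    = refl
      natrec-triangle (suc k) = cong (_+ suc k) (natrec-triangle k)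

    rep-pair : ∀ {n f g} → Rep n f → Rep n g → Rep n (λ xs → pair (f xs) (g xs))
    rep-pair = rep-comp₂ (rep-+ (rep-comp₁ rep-triangle (rep-+ #0 #1)) #1)

    rep-level : Rep 1 (λ v → level (lookup v zero))
    rep-level = rep-min< (rep-suc #0) (repB-<ᵇ #1 (rep-comp₁ rep-triangle (rep-suc #0)))

    rep-unpair₂ : ∀ {n f} → Rep n f → Rep n (λ xs → unpair₂ (f xs))
    rep-unpair₂ = rep-comp₁ (rep-∸ #0 (rep-comp₁ rep-triangle rep-level))

    rep-unpair₁ : ∀ {n f} → Rep n f → Rep n (λ xs → unpair₁ (f xs))
    rep-unpair₁ = rep-comp₁ (rep-∸ rep-level (rep-unpair₂ #0))

module ListCodes where

  open Representable
  open BoundedSearch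
  open Pairing
  open import Data.Nat
  open import Data.Nat.Properties
  open import Data.Bool using (if_then_else_)
  open import Data.Fin using (Fin; zero; suc; toℕ)
  open import Data.Vec using (Vec; []; _∷_; lookup)
  open import Data.List using (List; []; _∷_; length; drop; _++_; [_])
  open import Data.List.Properties using (length-++)
  open import Data.Product using (Σ; _,_; proj₁; proj₂)
  open import Relation.Binary.PropositionalEquality hiding ([_])

  -- Lists of naturals coded as 0 (empty) and 1 + pair x xs (cons); every number codes a list.
  cons : ℕ → ℕ → ℕ
  cons x z = suc (pair x z)

  encode : List ℕ → ℕ
  encode []      = 0
  encode (x ∷ l) = cons x (encode l)

  hd : ℕ → ℕ
  hd z = unpair₁ (pred z)

  tl : ℕ → ℕ
  tl z = unpair₂ (pred z)

  tl^ : ℕ → ℕ → ℕ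
  tl^ zero    z = z
  tl^ (suc i) z = tl (tl^ i z)

  nth : ℕ → ℕ → ℕ
  nth z i = hd (tl^ i z)

  isCons : ℕ → ℕ
  isCons zero    = 0
  isCons (suc _) = 1

  -- Counting the non-empty tails suffices because a code bounds the length of its list.
  len : ℕ → ℕ
  len z = sum< (suc z) (λ i → isCons (tl^ i z))

  index : List ℕ → ℕ → ℕ
  index []      i       = 0
  index (x ∷ l) zero    = x
  index (x ∷ l) (suc i) = index l i

  hd-cons : ∀ x z → hd (cons x z) ≡ x
  hd-cons = unpair₁-pair

  tl-cons : ∀ x z → tl (cons x z) ≡ z
  tl-cons = unpair₂-pair

  tl^-suc : ∀ i z → tl^ (suc i) z ≡ tl^ i (tl z)
  tl^-suc zero    z = refl
  tl^-suc (suc i) z = cong tl (tl^-suc i z)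

  nth-cons-zero : ∀ x z → nth (cons x z) 0 ≡ x
  nth-cons-zero = hd-cons

  nth-cons-suc : ∀ x z i → nth (cons x z) (suc i) ≡ nth z i
  nth-cons-suc x z i = cong hd (trans (tl^-suc i (cons x z)) (cong (tl^ i) (tl-cons x z)))

  tl^-encode : ∀ i L → tl^ i (encode L) ≡ encode (drop i L)
  tl^-encode zero    L       = refl
  tl^-encode (suc i) []      = tl^-0 (suc i)
    where
    tl^-0 : ∀ i → tl^ i 0 ≡ 0
    tl^-0 zero    = refl
    tl^-0 (suc i) = trans (cong tl (tl^-0 i)) (proj₂ unpair-0)
  tl^-encode (suc i) (x ∷ L) =
    trans (tl^-suc i (encode (x ∷ L))) (trans (cong (tl^ i) (tl-cons x (encode L))) (tl^-encode i L))

  nth-encode : ∀ L i → nth (encode L) i ≡ index L i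
  nth-encode L i rewrite tl^-encode i L = hd-drop L i
    where
    hd-drop : ∀ L i → hd (encode (drop i L)) ≡ index L i
    hd-drop []      zero    = proj₁ unpair-0
    hd-drop []      (suc i) = proj₁ unpair-0
    hd-drop (x ∷ L) zero    = hd-cons x (encode L)
    hd-drop (x ∷ L) (suc i) = hd-drop L i

  len-encode : ∀ L → len (encode L) ≡ length L
  len-encode L =
    trans (sum<-indicator (suc (encode L)) (length L) _
             (λ i _ → trans (cong isCons (tl^-encode i L)) (isCons-drop i L)))
          (m≥n⇒m⊓n≡n (≤-trans (length≤encode L) (n≤1+n _)))
    where
    length≤encode : ∀ L → length L ≤ encode L
    length≤encode []      = z≤n
    length≤encode (x ∷ L) = s≤s (≤-trans (length≤encode L) (≤-pair₂ x (encode L)))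
    isCons-drop : ∀ i (L : List ℕ) → isCons (encode (drop i L)) ≡ (if i <ᵇ length L then 1 else 0)
    isCons-drop zero    []      = refl
    isCons-drop zero    (x ∷ L) = refl
    isCons-drop (suc i) []      = refl
    isCons-drop (suc i) (x ∷ L) = isCons-drop i L
    sum<-indicator : ∀ N m (f : ℕ → ℕ) → (∀ i → i < N → f i ≡ (if i <ᵇ m then 1 else 0)) →
                     sum< N f ≡ N ⊓ m
    sum<-indicator zero    m f h = refl
    sum<-indicator (suc N) m f h
      rewrite sum<-indicator N m f (λ i i<N → h i (m<n⇒m<1+n i<N)) | h N ≤-refl = step N m
      where
      step : ∀ N m → N ⊓ m + (if N <ᵇ m then 1 else 0) ≡ suc N ⊓ m
      step zero    zero    = refl
      step zero    (suc m) = refl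
      step (suc N) zero    = refl
      step (suc N) (suc m) = cong suc (step N m)

  decodeFuel : ℕ → ℕ → List ℕ
  decodeFuel zero       z       = []
  decodeFuel (suc fuel) zero    = []
  decodeFuel (suc fuel) (suc z) = unpair₁ z ∷ decodeFuel fuel (unpair₂ z)

  encode-decodeFuel : ∀ fuel z → z < fuel → encode (decodeFuel fuel z) ≡ z
  encode-decodeFuel (suc fuel) zero    _         = refl
  encode-decodeFuel (suc fuel) (suc z) (s≤s z<f) =
    cong suc (trans (cong (pair (unpair₁ z)) (encode-decodeFuel fuel (unpair₂ z) unpair₂<fuel)) (pair-unpair z))
    where
    unpair₂<fuel : unpair₂ z < fuel
    unpair₂<fuel = ≤-<-trans (unpair₂-≤ z) (<-≤-trans (n<1+n z) z<f)

  decode : ℕ → List ℕ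
  decode z = decodeFuel (suc z) z

  encode-decode : ∀ z → encode (decode z) ≡ z
  encode-decode z = encode-decodeFuel (suc z) z ≤-refl

  len-cons : ∀ x z → len (cons x z) ≡ suc (len z)
  len-cons x z = begin
    len (cons x z)                   ≡⟨ cong (λ w → len (cons x w)) (sym (encode-decode z)) ⟩
    len (encode (x ∷ decode z))      ≡⟨ len-encode (x ∷ decode z) ⟩
    suc (length (decode z))          ≡⟨ cong suc (sym (len-encode (decode z))) ⟩
    suc (len (encode (decode z)))    ≡⟨ cong (λ w → suc (len w)) (encode-decode z) ⟩
    suc (len z)                      ∎
    where open ≡-Reasoning

  rep-cons : ∀ {n f g} → Rep n f → Rep n g → Rep n (λ xs → cons (f xs) (g xs))
  rep-cons rf rg = rep-suc (rep-pair rf rg)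

  rep-hd : ∀ {n f} → Rep n f → Rep n (λ xs → hd (f xs))
  rep-hd rf = rep-unpair₁ (rep-pred rf)

  rep-tl : ∀ {n f} → Rep n f → Rep n (λ xs → tl (f xs))
  rep-tl rf = rep-unpair₂ (rep-pred rf)

  rep-tl^ : Rep 2 (λ v → tl^ (lookup v zero) (lookup v (suc zero)))
  rep-tl^ = rep-ext (λ { (i ∷ z ∷ []) → natrec-tl^ i z }) (rep-natrec #0 (rep-tl #1))
    where
    natrec-tl^ : ∀ i z → natrec (λ v → lookup v zero) (λ v → tl (lookup v (suc zero))) (i ∷ z ∷ []) ≡ tl^ i z
    natrec-tl^ zero    z = refl
    natrec-tl^ (suc i) z = cong tl (natrec-tl^ i z)

  rep-nth : ∀ {n f g} → Rep n f → Rep n g → Rep n (λ xs → nth (f xs) (g xs))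
  rep-nth rf rg = rep-hd (rep-comp₂ rep-tl^ rg rf)

  rep-len : ∀ {n f} → Rep n f → Rep n (λ xs → len (f xs))
  rep-len = rep-comp₁ (rep-sum< (rep-suc #0) (rep-comp₁ rep-isCons (rep-comp₂ rep-tl^ #0 #1)))
    where
    rep-isCons : Rep 1 (λ v → isCons (lookup v zero))
    rep-isCons = rep-ext (λ { (zero ∷ []) → refl ; (suc x ∷ []) → refl }) (rep-natrec rep-zero (rep-const 1))

  len-0 : len 0 ≡ 0
  len-0 = len-encode []

  encodeVec : ∀ {n} → Vec ℕ n → ℕ
  encodeVec []       = 0
  encodeVec (x ∷ xs) = cons x (encodeVec xs)

  nth-encodeVec : ∀ {n} (xs : Vec ℕ n) (i : Fin n) → nth (encodeVec xs) (toℕ i) ≡ lookup xs i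
  nth-encodeVec (x ∷ xs) zero    = nth-cons-zero x (encodeVec xs)
  nth-encodeVec (x ∷ xs) (suc i) = trans (nth-cons-suc x (encodeVec xs) (toℕ i)) (nth-encodeVec xs i)

  len-encodeVec : ∀ {n} (xs : Vec ℕ n) → len (encodeVec xs) ≡ n
  len-encodeVec []       = len-0
  len-encodeVec (x ∷ xs) = trans (len-cons x (encodeVec xs)) (cong suc (len-encodeVec xs))

  decodeVec : ∀ m z → len z ≡ m → Σ (Vec ℕ m) λ v → encodeVec v ≡ z
  decodeVec m z len≡m =
    let (v , v≡) = fromList m (decode z) (trans (sym (len-encode (decode z))) (trans (cong len (encode-decode z)) len≡m))
    in v , trans v≡ (encode-decode z)
    where
    fromList : ∀ m (L : List ℕ) → length L ≡ m → Σ (Vec ℕ m) λ v → encodeVec v ≡ encode L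
    fromList zero    []      _   = [] , refl
    fromList (suc m) (x ∷ L) length≡ = let (v , v≡) = fromList m L (suc-injective length≡) in x ∷ v , cong (cons x) v≡

  index-++ˡ : ∀ (L₁ L₂ : List ℕ) j → j < length L₁ → index (L₁ ++ L₂) j ≡ index L₁ j
  index-++ˡ (x ∷ L₁) L₂ zero    _       = refl
  index-++ˡ (x ∷ L₁) L₂ (suc j) (s≤s j<) = index-++ˡ L₁ L₂ j j<

  index-++ʳ : ∀ (L₁ L₂ : List ℕ) j → index (L₁ ++ L₂) (length L₁ + j) ≡ index L₂ j
  index-++ʳ []       L₂ j = refl
  index-++ʳ (x ∷ L₁) L₂ j = index-++ʳ L₁ L₂ j

  length-snoc : ∀ (L : List ℕ) t → length (L ++ [ t ]) ≡ suc (length L)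
  length-snoc L t = trans (length-++ L) (+-comm (length L) 1)

  index-snoc : ∀ L t → index (L ++ [ t ]) (length L) ≡ t
  index-snoc L t = trans (cong (index (L ++ [ t ])) (sym (+-identityʳ (length L)))) (index-++ʳ L [ t ] 0)

module Certificates where

  open Representable
  open BoundedSearch
  open Pairing
  open ListCodes
  open import Data.Nat
  open import Data.Nat.Properties
  open import Data.Bool using (Bool; _∧_; _∨_; T)
  open import Data.Fin using (Fin; zero; suc; toℕ; fromℕ<)
  open import Data.Fin.Properties using (toℕ-fromℕ<; toℕ<n)
  open import Data.Vec using (Vec; []; _∷_; lookup)
  open import Data.List using (List; []; _∷_; length; _++_; [_])
  open import Data.List.Properties using (length-++)
  open import Data.Product using (Σ; ∃; _×_; _,_; proj₁; proj₂)
  open import Data.Sum using (inj₁; inj₂)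
  open import Data.Empty using (⊥-elim)
  open import Relation.Nullary using (yes; no)
  open import Relation.Binary.PropositionalEquality hiding ([_])
  open import Function using (id)

  mutual
    code : ∀ {n} → PR n → ℕ
    code zeroF       = pair 0 0
    code succF       = pair 1 0
    code (proj i)    = pair 2 (toℕ i)
    code (comp f gs) = pair 3 (pair (code f) (codeVec gs))
    code (prec f g)  = pair 4 (pair (code f) (code g))
    code (mu f)      = pair 5 (code f)

    codeVec : ∀ {n m} → Vec (PR n) m → ℕ
    codeVec []       = 0
    codeVec (g ∷ gs) = cons (code g) (codeVec gs)

  constructorTag : ∀ {n} → PR n → ℕ
  constructorTag zeroF       = 0
  constructorTag succF       = 1
  constructorTag (proj i)    = 2
  constructorTag (comp f gs) = 3
  constructorTag (prec f g)  = 4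
  constructorTag (mu f)      = 5

  -- A line triple c xs y claims that the program coded by c sends the arguments coded by xs to y.
  triple : ℕ → ℕ → ℕ → ℕ
  triple c xs y = pair c (pair xs y)

  line : ∀ {n} → PR n → Vec ℕ n → ℕ → ℕ
  line p xs y = triple (code p) (encodeVec xs) y

  lineProg lineArgs lineVal lineTag lineData : ℕ → ℕ
  lineProg t = unpair₁ t
  lineArgs t = unpair₁ (unpair₂ t)
  lineVal  t = unpair₂ (unpair₂ t)
  lineTag  t = unpair₁ (lineProg t)
  lineData t = unpair₂ (lineProg t)

  lineProg-triple : ∀ c xs y → lineProg (triple c xs y) ≡ c
  lineProg-triple c xs y = unpair₁-pair c _

  lineArgs-triple : ∀ c xs y → lineArgs (triple c xs y) ≡ xs
  lineArgs-triple c xs y rewrite unpair₂-pair c (pair xs y) = unpair₁-pair xs y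

  lineVal-triple : ∀ c xs y → lineVal (triple c xs y) ≡ y
  lineVal-triple c xs y rewrite unpair₂-pair c (pair xs y) = unpair₂-pair xs y

  triple-lines : ∀ t → triple (lineProg t) (lineArgs t) (lineVal t) ≡ t
  triple-lines t rewrite pair-unpair (unpair₂ t) = pair-unpair t

  lineData-triple : ∀ g x xs y → lineData (triple (pair g x) xs y) ≡ x
  lineData-triple g x xs y rewrite lineProg-triple (pair g x) xs y = unpair₂-pair g x

  lineTag-line : ∀ {n} (p : PR n) xs y → lineTag (line p xs y) ≡ constructorTag p
  lineTag-line p xs y rewrite lineProg-triple (code p) (encodeVec xs) y with p
  ... | zeroF     = unpair₁-pair _ _
  ... | succF     = unpair₁-pair _ _
  ... | proj _    = unpair₁-pair _ _
  ... | comp _ _  = unpair₁-pair _ _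
  ... | prec _ _  = unpair₁-pair _ _
  ... | mu _      = unpair₁-pair _ _

  cong₃ : ∀ {a b c a′ b′ c′} (g : ℕ → ℕ → ℕ → ℕ) → a ≡ a′ → b ≡ b′ → c ≡ c′ → g a b c ≡ g a′ b′ c′
  cong₃ g refl refl refl = refl

  -- Justified ℓ k t: the line t follows by one evaluation rule from the lines ℓ j with j < k.
  data Justified (ℓ : ℕ → ℕ) (k : ℕ) (t : ℕ) : Set where
    by-zero  : lineTag t ≡ 0 → lineVal t ≡ 0 → Justified ℓ k t
    by-succ  : lineTag t ≡ 1 → len (lineArgs t) ≡ 1 → lineVal t ≡ suc (nth (lineArgs t) 0) → Justified ℓ k t
    by-proj  : lineTag t ≡ 2 → lineData t < len (lineArgs t) → lineVal t ≡ nth (lineArgs t) (lineData t) →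
               Justified ℓ k t
    by-comp  : lineTag t ≡ 3 → (j : ℕ) → j < k →
               lineProg (ℓ j) ≡ unpair₁ (lineData t) → lineVal (ℓ j) ≡ lineVal t →
               len (lineArgs (ℓ j)) ≡ len (unpair₂ (lineData t)) →
               (∀ i → i < len (unpair₂ (lineData t)) → ∃ λ l → l < k ×
                  ℓ l ≡ triple (nth (unpair₂ (lineData t)) i) (lineArgs t) (nth (lineArgs (ℓ j)) i)) →
               Justified ℓ k t
    by-prec₀ : lineTag t ≡ 4 → hd (lineArgs t) ≡ 0 → (j : ℕ) → j < k →
               ℓ j ≡ triple (unpair₁ (lineData t)) (tl (lineArgs t)) (lineVal t) → Justified ℓ k t
    by-precₛ : lineTag t ≡ 4 → 0 < hd (lineArgs t) → (j : ℕ) → j < k →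
               lineProg (ℓ j) ≡ lineProg t → lineArgs (ℓ j) ≡ cons (pred (hd (lineArgs t))) (tl (lineArgs t)) →
               (l : ℕ) → l < k →
               ℓ l ≡ triple (unpair₂ (lineData t)) (cons (pred (hd (lineArgs t))) (cons (lineVal (ℓ j)) (tl (lineArgs t))))
                            (lineVal t) →
               Justified ℓ k t
    by-mu    : lineTag t ≡ 5 → (j : ℕ) → j < k → ℓ j ≡ triple (lineData t) (cons (lineVal t) (lineArgs t)) 0 →
               (∀ w → w < lineVal t → ∃ λ l → l < k × lineProg (ℓ l) ≡ lineData t ×
                  lineArgs (ℓ l) ≡ cons w (lineArgs t) × 0 < lineVal (ℓ l)) →
               Justified ℓ k t

  Justified-reindex : ∀ {ℓ ℓ′ k t} → Justified ℓ k t → (φ : ℕ → ℕ) →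
                      (∀ j → j < k → ℓ′ (φ j) ≡ ℓ j) → (∀ j → j < k → φ j < φ k) → Justified ℓ′ (φ k) t
  Justified-reindex (by-zero tag val) φ same mono = by-zero tag val
  Justified-reindex (by-succ tag args val) φ same mono = by-succ tag args val
  Justified-reindex (by-proj tag i< val) φ same mono = by-proj tag i< val
  Justified-reindex (by-comp tag j j<k prog val arity args) φ same mono =
    by-comp tag (φ j) (mono j j<k) (subst (λ w → lineProg w ≡ _) (sym (same j j<k)) prog)
            (subst (λ w → lineVal w ≡ _) (sym (same j j<k)) val) (subst (λ w → len (lineArgs w) ≡ _) (sym (same j j<k)) arity)
            λ i i< → let (l , l<k , at-l) = args i i< in
              φ l , mono l l<k , trans (same l l<k) (trans at-l (cong (λ w → triple _ _ (nth (lineArgs w) i)) (sym (same j j<k))))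
  Justified-reindex (by-prec₀ tag hd≡0 j j<k base) φ same mono =
    by-prec₀ tag hd≡0 (φ j) (mono j j<k) (trans (same j j<k) base)
  Justified-reindex (by-precₛ tag hd>0 j j<k prog args l l<k step) φ same mono =
    by-precₛ tag hd>0 (φ j) (mono j j<k) (subst (λ w → lineProg w ≡ _) (sym (same j j<k)) prog)
             (subst (λ w → lineArgs w ≡ _) (sym (same j j<k)) args) (φ l) (mono l l<k)
             (trans (same l l<k) (trans step (cong (λ w → triple _ (cons _ (cons (lineVal w) _)) _) (sym (same j j<k)))))
  Justified-reindex (by-mu tag j j<k root below) φ same mono =
    by-mu tag (φ j) (mono j j<k) (trans (same j j<k) root)
      λ w w< → let (l , l<k , prog , args , pos) = below w w< in
        φ l , mono l l<k , subst (λ u → lineProg u ≡ _) (sym (same l l<k)) prog ,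
        subst (λ u → lineArgs u ≡ _) (sym (same l l<k)) args , subst (λ u → 0 < lineVal u) (sym (same l l<k)) pos

  checkZero checkSucc checkProj : ℕ → Bool
  checkZero t = (lineTag t ≡ᵇ 0) ∧ (lineVal t ≡ᵇ 0)
  checkSucc t = (lineTag t ≡ᵇ 1) ∧ (len (lineArgs t) ≡ᵇ 1) ∧ (lineVal t ≡ᵇ suc (nth (lineArgs t) 0))
  checkProj t = (lineTag t ≡ᵇ 2) ∧ (lineData t <ᵇ len (lineArgs t)) ∧ (lineVal t ≡ᵇ nth (lineArgs t) (lineData t))

  checkComp checkPrec₀ checkPrecₛ checkMu : (ℕ → ℕ) → ℕ → Bool
  checkComp ℓ k = (lineTag t ≡ᵇ 3) ∧ any< k λ j →
      (lineProg (ℓ j) ≡ᵇ unpair₁ (lineData t)) ∧ (lineVal (ℓ j) ≡ᵇ lineVal t) ∧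
      (len (lineArgs (ℓ j)) ≡ᵇ len (unpair₂ (lineData t))) ∧
      all< (len (unpair₂ (lineData t))) λ i → any< k λ l →
        ℓ l ≡ᵇ triple (nth (unpair₂ (lineData t)) i) (lineArgs t) (nth (lineArgs (ℓ j)) i)
    where t = ℓ k
  checkPrec₀ ℓ k = (lineTag t ≡ᵇ 4) ∧ (hd (lineArgs t) ≡ᵇ 0) ∧ any< k λ j →
      ℓ j ≡ᵇ triple (unpair₁ (lineData t)) (tl (lineArgs t)) (lineVal t)
    where t = ℓ k
  checkPrecₛ ℓ k = (lineTag t ≡ᵇ 4) ∧ (0 <ᵇ hd (lineArgs t)) ∧ any< k λ j →
      (lineProg (ℓ j) ≡ᵇ lineProg t) ∧ (lineArgs (ℓ j) ≡ᵇ cons (pred (hd (lineArgs t))) (tl (lineArgs t))) ∧ any< k λ l →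
        ℓ l ≡ᵇ triple (unpair₂ (lineData t)) (cons (pred (hd (lineArgs t))) (cons (lineVal (ℓ j)) (tl (lineArgs t))))
                      (lineVal t)
    where t = ℓ k
  checkMu ℓ k = (lineTag t ≡ᵇ 5) ∧ (any< k λ j → ℓ j ≡ᵇ triple (lineData t) (cons (lineVal t) (lineArgs t)) 0) ∧
      all< (lineVal t) λ w → any< k λ l →
        (lineProg (ℓ l) ≡ᵇ lineData t) ∧ (lineArgs (ℓ l) ≡ᵇ cons w (lineArgs t)) ∧ (0 <ᵇ lineVal (ℓ l))
    where t = ℓ k

  justified? : (ℕ → ℕ) → ℕ → Bool
  justified? ℓ k = checkZero (ℓ k) ∨ checkSucc (ℓ k) ∨ checkProj (ℓ k) ∨
                   checkComp ℓ k ∨ checkPrec₀ ℓ k ∨ checkPrecₛ ℓ k ∨ checkMu ℓ k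

  checkZero-sound : ∀ ℓ k → T (checkZero (ℓ k)) → Justified ℓ k (ℓ k)
  checkZero-sound ℓ k ok = let (tag , val) = ∧-split _ ok in by-zero (T⇒≡ tag) (T⇒≡ val)

  checkSucc-sound : ∀ ℓ k → T (checkSucc (ℓ k)) → Justified ℓ k (ℓ k)
  checkSucc-sound ℓ k ok =
    let (tag , ok) = ∧-split _ ok ; (arity , val) = ∧-split _ ok in by-succ (T⇒≡ tag) (T⇒≡ arity) (T⇒≡ val)

  checkProj-sound : ∀ ℓ k → T (checkProj (ℓ k)) → Justified ℓ k (ℓ k)
  checkProj-sound ℓ k ok =
    let (tag , ok) = ∧-split _ ok ; (i< , val) = ∧-split _ ok in by-proj (T⇒≡ tag) (T⇒< i<) (T⇒≡ val)

  checkComp-sound : ∀ ℓ k → T (checkComp ℓ k) → Justified ℓ k (ℓ k)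
  checkComp-sound ℓ k ok =
    let (tag , ok) = ∧-split _ ok ; (j , j<k , ok) = any<-elim k _ ok
        (prog , ok) = ∧-split _ ok ; (val , ok) = ∧-split _ ok ; (arity , args) = ∧-split _ ok
    in by-comp (T⇒≡ tag) j j<k (T⇒≡ prog) (T⇒≡ val) (T⇒≡ arity)
         λ i i< → let (l , l<k , at-l) = any<-elim k _ (all<-elim _ _ args i i<) in l , l<k , T⇒≡ at-l

  checkPrec₀-sound : ∀ ℓ k → T (checkPrec₀ ℓ k) → Justified ℓ k (ℓ k)
  checkPrec₀-sound ℓ k ok =
    let (tag , ok) = ∧-split _ ok ; (hd≡0 , ok) = ∧-split _ ok ; (j , j<k , base) = any<-elim k _ ok
    in by-prec₀ (T⇒≡ tag) (T⇒≡ hd≡0) j j<k (T⇒≡ base)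

  checkPrecₛ-sound : ∀ ℓ k → T (checkPrecₛ ℓ k) → Justified ℓ k (ℓ k)
  checkPrecₛ-sound ℓ k ok =
    let (tag , ok) = ∧-split _ ok ; (hd>0 , ok) = ∧-split _ ok ; (j , j<k , ok) = any<-elim k _ ok
        (prog , ok) = ∧-split _ ok ; (args , ok) = ∧-split _ ok ; (l , l<k , step) = any<-elim k _ ok
    in by-precₛ (T⇒≡ tag) (T⇒< hd>0) j j<k (T⇒≡ prog) (T⇒≡ args) l l<k (T⇒≡ step)

  checkMu-sound : ∀ ℓ k → T (checkMu ℓ k) → Justified ℓ k (ℓ k)
  checkMu-sound ℓ k ok =
    let (tag , ok) = ∧-split _ ok ; (root , below) = ∧-split _ ok ; (j , j<k , root) = any<-elim k _ root
    in by-mu (T⇒≡ tag) j j<k (T⇒≡ root)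
         λ w w< → let (l , l<k , ok) = any<-elim k _ (all<-elim _ _ below w w<)
                      (prog , ok) = ∧-split _ ok ; (args , pos) = ∧-split _ ok
                  in l , l<k , T⇒≡ prog , T⇒≡ args , T⇒< pos

  justified?-sound : ∀ ℓ k → T (justified? ℓ k) → Justified ℓ k (ℓ k)
  justified?-sound ℓ k ok with ∨-elim _ ok
  ... | inj₁ ok = checkZero-sound ℓ k ok
  ... | inj₂ ok with ∨-elim _ ok
  ... | inj₁ ok = checkSucc-sound ℓ k ok
  ... | inj₂ ok with ∨-elim _ ok
  ... | inj₁ ok = checkProj-sound ℓ k ok
  ... | inj₂ ok with ∨-elim _ ok
  ... | inj₁ ok = checkComp-sound ℓ k ok
  ... | inj₂ ok with ∨-elim _ ok
  ... | inj₁ ok = checkPrec₀-sound ℓ k ok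
  ... | inj₂ ok with ∨-elim _ ok
  ... | inj₁ ok = checkPrecₛ-sound ℓ k ok
  ... | inj₂ ok = checkMu-sound ℓ k ok

  justified?-complete : ∀ ℓ k → Justified ℓ k (ℓ k) → T (justified? ℓ k)
  justified?-complete ℓ k (by-zero tag val) =
    ∨-inl (checkZero t) (∧-intro (lineTag t ≡ᵇ 0) (≡⇒T tag) (≡⇒T val))
    where t = ℓ k
  justified?-complete ℓ k (by-succ tag arity val) =
    ∨-inr (checkZero t) (∨-inl (checkSucc t)
      (∧-intro (lineTag t ≡ᵇ 1) (≡⇒T tag) (∧-intro (len (lineArgs t) ≡ᵇ 1) (≡⇒T arity) (≡⇒T val))))
    where t = ℓ k
  justified?-complete ℓ k (by-proj tag i< val) =
    ∨-inr (checkZero t) (∨-inr (checkSucc t) (∨-inl (checkProj t)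
      (∧-intro (lineTag t ≡ᵇ 2) (≡⇒T tag) (∧-intro (lineData t <ᵇ len (lineArgs t)) (<⇒T i<) (≡⇒T val)))))
    where t = ℓ k
  justified?-complete ℓ k (by-comp tag j j<k prog val arity args) =
    ∨-inr (checkZero t) (∨-inr (checkSucc t) (∨-inr (checkProj t) (∨-inl (checkComp ℓ k)
      (∧-intro (lineTag t ≡ᵇ 3) (≡⇒T tag) (any<-intro k _ j j<k
        (∧-intro (lineProg (ℓ j) ≡ᵇ unpair₁ (lineData t)) (≡⇒T prog)
        (∧-intro (lineVal (ℓ j) ≡ᵇ lineVal t) (≡⇒T val)
        (∧-intro (len (lineArgs (ℓ j)) ≡ᵇ len (unpair₂ (lineData t))) (≡⇒T arity)
        (all<-intro _ _ λ i i< → let (l , l<k , at-l) = args i i< in any<-intro k _ l l<k (≡⇒T at-l))))))))))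
    where t = ℓ k
  justified?-complete ℓ k (by-prec₀ tag hd≡0 j j<k base) =
    ∨-inr (checkZero t) (∨-inr (checkSucc t) (∨-inr (checkProj t) (∨-inr (checkComp ℓ k) (∨-inl (checkPrec₀ ℓ k)
      (∧-intro (lineTag t ≡ᵇ 4) (≡⇒T tag) (∧-intro (hd (lineArgs t) ≡ᵇ 0) (≡⇒T hd≡0) (any<-intro k _ j j<k (≡⇒T base))))))))
    where t = ℓ k
  justified?-complete ℓ k (by-precₛ tag hd>0 j j<k prog args l l<k step) =
    ∨-inr (checkZero t) (∨-inr (checkSucc t) (∨-inr (checkProj t) (∨-inr (checkComp ℓ k) (∨-inr (checkPrec₀ ℓ k)
      (∨-inl (checkPrecₛ ℓ k)
        (∧-intro (lineTag t ≡ᵇ 4) (≡⇒T tag) (∧-intro (0 <ᵇ hd (lineArgs t)) (<⇒T hd>0) (any<-intro k _ j j<k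
          (∧-intro (lineProg (ℓ j) ≡ᵇ lineProg t) (≡⇒T prog)
          (∧-intro (lineArgs (ℓ j) ≡ᵇ cons (pred (hd (lineArgs t))) (tl (lineArgs t))) (≡⇒T args)
          (any<-intro k _ l l<k (≡⇒T step))))))))))))
    where t = ℓ k
  justified?-complete ℓ k (by-mu tag j j<k root below) =
    ∨-inr (checkZero t) (∨-inr (checkSucc t) (∨-inr (checkProj t) (∨-inr (checkComp ℓ k) (∨-inr (checkPrec₀ ℓ k)
      (∨-inr (checkPrecₛ ℓ k)
        (∧-intro (lineTag t ≡ᵇ 5) (≡⇒T tag)
        (∧-intro (any< k λ j → ℓ j ≡ᵇ triple (lineData t) (cons (lineVal t) (lineArgs t)) 0) (any<-intro k _ j j<k (≡⇒T root))
        (all<-intro _ _ λ w w< → let (l , l<k , prog , args , pos) = below w w< in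
          any<-intro k _ l l<k (∧-intro (lineProg (ℓ l) ≡ᵇ lineData t) (≡⇒T prog)
                               (∧-intro (lineArgs (ℓ l) ≡ᵇ cons w (lineArgs t)) (≡⇒T args) (<⇒T pos)))))))))))
    where t = ℓ k

  rep-lineProg : ∀ {n f} → Rep n f → Rep n (λ xs → lineProg (f xs))
  rep-lineProg = rep-unpair₁

  rep-lineArgs : ∀ {n f} → Rep n f → Rep n (λ xs → lineArgs (f xs))
  rep-lineArgs r = rep-unpair₁ (rep-unpair₂ r)

  rep-lineVal : ∀ {n f} → Rep n f → Rep n (λ xs → lineVal (f xs))
  rep-lineVal r = rep-unpair₂ (rep-unpair₂ r)

  rep-lineTag : ∀ {n f} → Rep n f → Rep n (λ xs → lineTag (f xs))
  rep-lineTag r = rep-unpair₁ (rep-lineProg r)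

  rep-lineData : ∀ {n f} → Rep n f → Rep n (λ xs → lineData (f xs))
  rep-lineData r = rep-unpair₂ (rep-lineProg r)

  rep-triple : ∀ {n f g h} → Rep n f → Rep n g → Rep n h → Rep n (λ xs → triple (f xs) (g xs) (h xs))
  rep-triple rf rg rh = rep-pair rf (rep-pair rg rh)

  -- The arguments are the list code z and the line index k; bounded quantifiers push their variable in front.
  repB-justified? : RepB 2 (λ v → justified? (nth (lookup v zero)) (lookup v (suc zero)))
  repB-justified? =
    repB-∨ zero-ok (repB-∨ succ-ok (repB-∨ proj-ok (repB-∨ comp-ok (repB-∨ prec₀-ok (repB-∨ precₛ-ok mu-ok)))))
    where
    t : Rep 2 (λ v → nth (lookup v zero) (lookup v (suc zero)))
    t = rep-nth #0 #1
    t₃ : Rep 3 (λ v → nth (lookup v (suc zero)) (lookup v (suc (suc zero))))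
    t₃ = rep-nth #1 #2
    t₄ : Rep 4 (λ v → nth (lookup v (suc (suc zero))) (lookup v (suc (suc (suc zero)))))
    t₄ = rep-nth #2 #3
    line-j₃ : Rep 3 (λ v → nth (lookup v (suc zero)) (lookup v zero))
    line-j₃ = rep-nth #1 #0
    zero-ok = repB-∧ (repB-≡ᵇ (rep-lineTag t) (rep-const 0)) (repB-≡ᵇ (rep-lineVal t) (rep-const 0))
    succ-ok = repB-∧ (repB-≡ᵇ (rep-lineTag t) (rep-const 1)) (repB-∧ (repB-≡ᵇ (rep-len (rep-lineArgs t)) (rep-const 1))
                (repB-≡ᵇ (rep-lineVal t) (rep-suc (rep-nth (rep-lineArgs t) (rep-const 0)))))
    proj-ok = repB-∧ (repB-≡ᵇ (rep-lineTag t) (rep-const 2)) (repB-∧ (repB-<ᵇ (rep-lineData t) (rep-len (rep-lineArgs t)))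
                (repB-≡ᵇ (rep-lineVal t) (rep-nth (rep-lineArgs t) (rep-lineData t))))
    comp-ok = repB-∧ (repB-≡ᵇ (rep-lineTag t) (rep-const 3)) (repB-any< #1
                (repB-∧ (repB-≡ᵇ (rep-lineProg line-j₃) (rep-unpair₁ (rep-lineData t₃)))
                (repB-∧ (repB-≡ᵇ (rep-lineVal line-j₃) (rep-lineVal t₃))
                (repB-∧ (repB-≡ᵇ (rep-len (rep-lineArgs line-j₃)) (rep-len (rep-unpair₂ (rep-lineData t₃))))
                (repB-all< (rep-len (rep-unpair₂ (rep-lineData t₃)))
                  (repB-any< #3 (repB-≡ᵇ (rep-nth #3 #0)
                    (rep-triple (rep-nth (rep-unpair₂ (rep-lineData (rep-nth #3 #4))) #1) (rep-lineArgs (rep-nth #3 #4))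
                                (rep-nth (rep-lineArgs (rep-nth #3 #2)) #1)))))))))
    prec₀-ok = repB-∧ (repB-≡ᵇ (rep-lineTag t) (rep-const 4)) (repB-∧ (repB-≡ᵇ (rep-hd (rep-lineArgs t)) (rep-const 0))
                 (repB-any< #1 (repB-≡ᵇ line-j₃ (rep-triple (rep-unpair₁ (rep-lineData t₃)) (rep-tl (rep-lineArgs t₃))
                                                             (rep-lineVal t₃)))))
    precₛ-ok = repB-∧ (repB-≡ᵇ (rep-lineTag t) (rep-const 4)) (repB-∧ (repB-<ᵇ (rep-const 0) (rep-hd (rep-lineArgs t)))
                 (repB-any< #1 (repB-∧ (repB-≡ᵇ (rep-lineProg line-j₃) (rep-lineProg t₃))
                   (repB-∧ (repB-≡ᵇ (rep-lineArgs line-j₃)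
                                    (rep-cons (rep-pred (rep-hd (rep-lineArgs t₃))) (rep-tl (rep-lineArgs t₃))))
                     (repB-any< #2 (repB-≡ᵇ (rep-nth #2 #0)
                       (rep-triple (rep-unpair₂ (rep-lineData t₄))
                                   (rep-cons (rep-pred (rep-hd (rep-lineArgs t₄)))
                                             (rep-cons (rep-lineVal (rep-nth #2 #1)) (rep-tl (rep-lineArgs t₄))))
                                   (rep-lineVal t₄))))))))
    mu-ok = repB-∧ (repB-≡ᵇ (rep-lineTag t) (rep-const 5)) (repB-∧
              (repB-any< #1 (repB-≡ᵇ line-j₃
                (rep-triple (rep-lineData t₃) (rep-cons (rep-lineVal t₃) (rep-lineArgs t₃)) (rep-const 0))))
              (repB-all< (rep-lineVal t) (repB-any< #2 (repB-∧ (repB-≡ᵇ (rep-lineProg (rep-nth #2 #0)) (rep-lineData t₄))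
                (repB-∧ (repB-≡ᵇ (rep-lineArgs (rep-nth #2 #0)) (rep-cons #1 (rep-lineArgs t₄)))
                        (repB-<ᵇ (rep-const 0) (rep-lineVal (rep-nth #2 #0))))))))

  isCertificate : ℕ → Bool
  isCertificate z = all< (len z) (justified? (nth z))

  certifies : ℕ → ℕ → ℕ → Bool
  certifies z e a = any< (len z) λ k → (lineProg (nth z k) ≡ᵇ e) ∧ (lineArgs (nth z k) ≡ᵇ cons a 0)

  haltsWithin : ℕ → ℕ → ℕ → Bool
  haltsWithin e a s = any< s λ z → isCertificate z ∧ certifies z e a

  repB-haltsWithin : ∀ {n fe fa fs} → Rep n fe → Rep n fa → Rep n fs →
                     RepB n (λ xs → haltsWithin (fe xs) (fa xs) (fs xs))
  repB-haltsWithin = rep-comp₃ (repB-any< #2 (repB-∧ (rep-comp₁ repB-isCertificate #0)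
    (repB-any< (rep-len #0) (repB-∧ (repB-≡ᵇ (rep-lineProg (rep-nth #1 #0)) #2)
                                    (repB-≡ᵇ (rep-lineArgs (rep-nth #1 #0)) (rep-cons #3 (rep-const 0)))))))
    where
    repB-isCertificate : RepB 1 (λ v → isCertificate (lookup v zero))
    repB-isCertificate = repB-all< (rep-len #0) (rep-comp₂ repB-justified? #1 #0)

  AllJustified : (ℕ → ℕ) → ℕ → Set
  AllJustified ℓ k = ∀ j → j ≤ k → Justified ℓ j (ℓ j)

  mismatch : ∀ {n} (p : PR n) {xs y h} {A : Set} → lineTag (line p xs y) ≡ h → constructorTag p ≢ h → A
  mismatch p {xs} {y} tag tag≢ = ⊥-elim (tag≢ (trans (sym (lineTag-line p xs y)) tag))

  evalVec-lookup : ∀ {n m} (gs : Vec (PR n) m) xs (ys : Vec ℕ m) →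
                   (∀ i → Eval (lookup gs i) xs (lookup ys i)) → EvalVec gs xs ys
  evalVec-lookup []       xs []       ev = evv-[]
  evalVec-lookup (g ∷ gs) xs (y ∷ ys) ev = evv-∷ (ev zero) (evalVec-lookup gs xs ys (λ i → ev (suc i)))

  nth-codeVec : ∀ {n m} (gs : Vec (PR n) m) (i : Fin m) → nth (codeVec gs) (toℕ i) ≡ code (lookup gs i)
  nth-codeVec (g ∷ gs) zero    = nth-cons-zero (code g) (codeVec gs)
  nth-codeVec (g ∷ gs) (suc i) = trans (nth-cons-suc (code g) (codeVec gs) (toℕ i)) (nth-codeVec gs i)

  len-codeVec : ∀ {n m} (gs : Vec (PR n) m) → len (codeVec gs) ≡ m
  len-codeVec []       = len-0
  len-codeVec (g ∷ gs) = trans (len-cons (code g) (codeVec gs)) (cong suc (len-codeVec gs))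

  TrueBefore : (ℕ → ℕ) → ℕ → Set
  TrueBefore ℓ k = ∀ j → j < k → ∀ {n} (p : PR n) xs y → ℓ j ≡ line p xs y → Eval p xs y

  TrueBefore-val : ∀ {ℓ k} → TrueBefore ℓ k → ∀ j → j < k → ∀ {n} (p : PR n) xs →
                   lineProg (ℓ j) ≡ code p → lineArgs (ℓ j) ≡ encodeVec xs → Eval p xs (lineVal (ℓ j))
  TrueBefore-val {ℓ} earlier j j<k p xs prog args =
    earlier j j<k p xs _ (trans (sym (triple-lines (ℓ j))) (cong₂ (λ c a → triple c a (lineVal (ℓ j))) prog args))

  comp-sound : ∀ {ℓ k m n} → TrueBefore ℓ k → (f : PR m) (gs : Vec (PR n) m) → ∀ xs y →
               Justified ℓ k (line (comp f gs) xs y) → Eval (comp f gs) xs y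
  comp-sound {ℓ} earlier f gs xs y (by-comp _ j j<k prog val arity args) = ev-comp (evalVec-lookup gs xs ys eval-gs) eval-f
    where
    data≡ : lineData (line (comp f gs) xs y) ≡ pair (code f) (codeVec gs)
    data≡ = lineData-triple 3 _ (encodeVec xs) y
    arity≡ : len (unpair₂ (lineData (line (comp f gs) xs y))) ≡ _
    arity≡ = trans (cong (λ w → len (unpair₂ w)) data≡)
                   (trans (cong len (unpair₂-pair (code f) (codeVec gs))) (len-codeVec gs))
    ys-code = decodeVec _ (lineArgs (ℓ j)) (trans arity arity≡)
    ys = proj₁ ys-code
    eval-f : Eval f ys y
    eval-f = subst (Eval f ys) (trans val (lineVal-triple _ (encodeVec xs) y))
                   (TrueBefore-val earlier j j<k f ys
                                   (trans prog (trans (cong unpair₁ data≡) (unpair₁-pair (code f) (codeVec gs))))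
                                   (sym (proj₂ ys-code)))
    eval-gs : ∀ i → Eval (lookup gs i) xs (lookup ys i)
    eval-gs i = let (l , l<k , at-l) = args (toℕ i) (subst (toℕ i <_) (sym arity≡) (toℕ<n i)) in
      earlier l l<k (lookup gs i) xs (lookup ys i) (trans at-l (cong₃ triple
        (trans (cong (λ w → nth (unpair₂ w) (toℕ i)) data≡)
               (trans (cong (λ w → nth w (toℕ i)) (unpair₂-pair (code f) (codeVec gs))) (nth-codeVec gs i)))
        (lineArgs-triple _ (encodeVec xs) y)
        (trans (cong (λ w → nth w (toℕ i)) (sym (proj₂ ys-code))) (nth-encodeVec ys i))))
  comp-sound earlier f gs xs y (by-zero  tag _)               = mismatch (comp f gs) tag λ ()
  comp-sound earlier f gs xs y (by-succ  tag _ _)             = mismatch (comp f gs) tag λ ()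
  comp-sound earlier f gs xs y (by-proj  tag _ _)             = mismatch (comp f gs) tag λ ()
  comp-sound earlier f gs xs y (by-prec₀ tag _ _ _ _)         = mismatch (comp f gs) tag λ ()
  comp-sound earlier f gs xs y (by-precₛ tag _ _ _ _ _ _ _ _) = mismatch (comp f gs) tag λ ()
  comp-sound earlier f gs xs y (by-mu    tag _ _ _ _)         = mismatch (comp f gs) tag λ ()

  prec-sound : ∀ {ℓ k n} → TrueBefore ℓ k → (f : PR n) (g : PR (2 + n)) → ∀ xs y →
               Justified ℓ k (line (prec f g) xs y) → Eval (prec f g) xs y
  prec-sound earlier f g (zero ∷ xs) y (by-prec₀ _ _ j j<k base) = ev-prec0 (earlier j j<k f xs y (trans base base≡))
    where
    t = line (prec f g) (zero ∷ xs) y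
    base≡ : triple (unpair₁ (lineData t)) (tl (lineArgs t)) (lineVal t) ≡ line f xs y
    base≡ = cong₃ triple (trans (cong unpair₁ (lineData-triple 4 _ _ y)) (unpair₁-pair _ _))
                         (trans (cong tl (lineArgs-triple _ _ y)) (tl-cons 0 (encodeVec xs)))
                         (lineVal-triple _ _ y)
  prec-sound earlier f g (zero ∷ xs) y (by-precₛ _ hd>0 _ _ _ _ _ _ _) =
    ⊥-elim (<-irrefl (sym (trans (cong hd (lineArgs-triple _ _ y)) (hd-cons 0 (encodeVec xs)))) hd>0)
  prec-sound {ℓ} earlier f g (suc n ∷ xs) y (by-precₛ _ _ j j<k prog args l l<k step) = ev-precS eval-prev eval-step
    where
    t = line (prec f g) (suc n ∷ xs) y
    pred-hd : pred (hd (lineArgs t)) ≡ n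
    pred-hd = cong pred (trans (cong hd (lineArgs-triple _ _ y)) (hd-cons (suc n) (encodeVec xs)))
    tl≡ : tl (lineArgs t) ≡ encodeVec xs
    tl≡ = trans (cong tl (lineArgs-triple _ _ y)) (tl-cons (suc n) (encodeVec xs))
    eval-prev : Eval (prec f g) (n ∷ xs) (lineVal (ℓ j))
    eval-prev = TrueBefore-val earlier j j<k (prec f g) (n ∷ xs) (trans prog (lineProg-triple _ _ y))
                               (trans args (cong₂ cons pred-hd tl≡))
    eval-step : Eval g (n ∷ lineVal (ℓ j) ∷ xs) y
    eval-step = earlier l l<k g (n ∷ lineVal (ℓ j) ∷ xs) y (trans step (cong₃ triple
      (trans (cong unpair₂ (lineData-triple 4 _ _ y)) (unpair₂-pair _ _))
      (cong₂ cons pred-hd (cong (cons (lineVal (ℓ j))) tl≡))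
      (lineVal-triple _ _ y)))
  prec-sound earlier f g (suc n ∷ xs) y (by-prec₀ _ hd≡0 _ _ _) =
    ⊥-elim (0≢1+n (trans (sym hd≡0) (trans (cong hd (lineArgs-triple _ _ y)) (hd-cons (suc n) (encodeVec xs)))))
  prec-sound earlier f g xs y (by-zero tag _)           = mismatch (prec f g) tag λ ()
  prec-sound earlier f g xs y (by-succ tag _ _)         = mismatch (prec f g) tag λ ()
  prec-sound earlier f g xs y (by-proj tag _ _)         = mismatch (prec f g) tag λ ()
  prec-sound earlier f g xs y (by-comp tag _ _ _ _ _ _) = mismatch (prec f g) tag λ ()
  prec-sound earlier f g xs y (by-mu   tag _ _ _ _)     = mismatch (prec f g) tag λ ()

  mu-sound : ∀ {ℓ k n} → TrueBefore ℓ k → (f : PR (suc n)) → ∀ xs y →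
             Justified ℓ k (line (mu f) xs y) → Eval (mu f) xs y
  mu-sound {ℓ} earlier f xs y (by-mu _ j j<k root below) = ev-mu eval-root eval-below
    where
    data≡ : lineData (line (mu f) xs y) ≡ code f
    data≡ = lineData-triple 5 _ (encodeVec xs) y
    eval-root : Eval f (y ∷ xs) 0
    eval-root = earlier j j<k f (y ∷ xs) 0
      (trans root (cong₂ (λ c a → triple c a 0) data≡ (cong₂ cons (lineVal-triple _ _ y) (lineArgs-triple _ _ y))))
    eval-below : ∀ z → z < y → ∃ λ v → Eval f (z ∷ xs) (suc v)
    eval-below z z<y with below z (subst (z <_) (sym (lineVal-triple _ _ y)) z<y)
    ... | (l , l<k , prog , args , pos) =
      pred (lineVal (ℓ l)) , subst (Eval f (z ∷ xs)) (sym (suc-pred (lineVal (ℓ l)) {{>-nonZero pos}}))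
        (TrueBefore-val earlier l l<k f (z ∷ xs) (trans prog data≡) (trans args (cong (cons z) (lineArgs-triple _ _ y))))
  mu-sound earlier f xs y (by-zero  tag _)               = mismatch (mu f) tag λ ()
  mu-sound earlier f xs y (by-succ  tag _ _)             = mismatch (mu f) tag λ ()
  mu-sound earlier f xs y (by-proj  tag _ _)             = mismatch (mu f) tag λ ()
  mu-sound earlier f xs y (by-comp  tag _ _ _ _ _ _)     = mismatch (mu f) tag λ ()
  mu-sound earlier f xs y (by-prec₀ tag _ _ _ _)         = mismatch (mu f) tag λ ()
  mu-sound earlier f xs y (by-precₛ tag _ _ _ _ _ _ _ _) = mismatch (mu f) tag λ ()

  line-sound : ∀ {ℓ k n} → TrueBefore ℓ k → (p : PR n) → ∀ xs y → Justified ℓ k (line p xs y) → Eval p xs y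
  line-sound earlier zeroF xs y (by-zero _ val) = subst (Eval zeroF xs) (sym (trans (sym (lineVal-triple _ _ y)) val)) ev-zero
  line-sound earlier zeroF xs y (by-succ  tag _ _)             = mismatch zeroF tag λ ()
  line-sound earlier zeroF xs y (by-proj  tag _ _)             = mismatch zeroF tag λ ()
  line-sound earlier zeroF xs y (by-comp  tag _ _ _ _ _ _)     = mismatch zeroF tag λ ()
  line-sound earlier zeroF xs y (by-prec₀ tag _ _ _ _)         = mismatch zeroF tag λ ()
  line-sound earlier zeroF xs y (by-precₛ tag _ _ _ _ _ _ _ _) = mismatch zeroF tag λ ()
  line-sound earlier zeroF xs y (by-mu    tag _ _ _ _)         = mismatch zeroF tag λ ()
  line-sound earlier succF (x ∷ []) y (by-succ _ _ val) = subst (Eval succF (x ∷ [])) (sym y≡) ev-succ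
    where
    y≡ : y ≡ suc x
    y≡ = trans (sym (lineVal-triple _ _ y))
               (trans val (cong suc (trans (cong (λ w → nth w 0) (lineArgs-triple _ _ y)) (nth-cons-zero x 0))))
  line-sound earlier succF xs y (by-zero  tag _)               = mismatch succF tag λ ()
  line-sound earlier succF xs y (by-proj  tag _ _)             = mismatch succF tag λ ()
  line-sound earlier succF xs y (by-comp  tag _ _ _ _ _ _)     = mismatch succF tag λ ()
  line-sound earlier succF xs y (by-prec₀ tag _ _ _ _)         = mismatch succF tag λ ()
  line-sound earlier succF xs y (by-precₛ tag _ _ _ _ _ _ _ _) = mismatch succF tag λ ()
  line-sound earlier succF xs y (by-mu    tag _ _ _ _)         = mismatch succF tag λ ()
  line-sound earlier (proj i) xs y (by-proj _ _ val) = subst (Eval (proj i) xs) (sym y≡) (ev-proj i)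
    where
    y≡ : y ≡ lookup xs i
    y≡ = trans (sym (lineVal-triple _ _ y))
               (trans val (trans (cong₂ nth (lineArgs-triple _ _ y) (lineData-triple 2 (toℕ i) _ y)) (nth-encodeVec xs i)))
  line-sound earlier (proj i) xs y (by-zero  tag _)               = mismatch (proj i) tag λ ()
  line-sound earlier (proj i) xs y (by-succ  tag _ _)             = mismatch (proj i) tag λ ()
  line-sound earlier (proj i) xs y (by-comp  tag _ _ _ _ _ _)     = mismatch (proj i) tag λ ()
  line-sound earlier (proj i) xs y (by-prec₀ tag _ _ _ _)         = mismatch (proj i) tag λ ()
  line-sound earlier (proj i) xs y (by-precₛ tag _ _ _ _ _ _ _ _) = mismatch (proj i) tag λ ()
  line-sound earlier (proj i) xs y (by-mu    tag _ _ _ _)         = mismatch (proj i) tag λ ()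
  line-sound earlier (comp f gs) = comp-sound earlier f gs
  line-sound earlier (prec f g)  = prec-sound earlier f g
  line-sound earlier (mu f)      = mu-sound earlier f

  -- Induction on the line index; the fuel only makes the recursion structural.
  justified-sound : ∀ fuel ℓ k → k < fuel → AllJustified ℓ k →
                    ∀ {n} (p : PR n) xs y → ℓ k ≡ line p xs y → Eval p xs y
  justified-sound (suc fuel) ℓ k (s≤s k≤fuel) all p xs y ℓk≡ =
    line-sound earlier p xs y (subst (Justified ℓ k) ℓk≡ (all k ≤-refl))
    where
    earlier : TrueBefore ℓ k
    earlier j j<k = justified-sound fuel ℓ j (<-≤-trans j<k k≤fuel) (λ i i≤j → all i (≤-trans i≤j (<⇒≤ j<k)))

  Valid : List ℕ → Set
  Valid L = ∀ j → j < length L → Justified (index L) j (index L j)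

  Contains : List ℕ → ℕ → Set
  Contains L t = ∃ λ k → k < length L × index L k ≡ t

  Certificate : ∀ {n} → PR n → Vec ℕ n → ℕ → Set
  Certificate p xs y = Σ (List ℕ) λ L → Valid L × Contains L (line p xs y)

  Valid-[] : Valid []
  Valid-[] j ()

  Valid-++ : ∀ L₁ L₂ → Valid L₁ → Valid L₂ → Valid (L₁ ++ L₂)
  Valid-++ L₁ L₂ valid₁ valid₂ j j< with j <? length L₁
  ... | yes j<₁ = subst (Justified (index (L₁ ++ L₂)) j) (sym (index-++ˡ L₁ L₂ j j<₁))
                    (Justified-reindex (valid₁ j j<₁) id (λ i i<j → index-++ˡ L₁ L₂ i (<-trans i<j j<₁)) (λ i i<j → i<j))
  ... | no j≮₁ = subst (λ w → Justified (index (L₁ ++ L₂)) w (index (L₁ ++ L₂) w)) shift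
                   (subst (Justified (index (L₁ ++ L₂)) (length L₁ + j₂)) (sym (index-++ʳ L₁ L₂ j₂))
                     (Justified-reindex (valid₂ j₂ j₂<) (length L₁ +_) (λ i _ → index-++ʳ L₁ L₂ i)
                                        (λ i i<j → +-monoʳ-< (length L₁) i<j)))
    where
    j₂ = j ∸ length L₁
    shift : length L₁ + j₂ ≡ j
    shift = m+[n∸m]≡n (≮⇒≥ j≮₁)
    j₂< : j₂ < length L₂
    j₂< = +-cancelˡ-< (length L₁) j₂ (length L₂)
            (subst (_< length L₁ + length L₂) (sym shift) (subst (j <_) (length-++ L₁ {L₂}) j<))

  Valid-snoc : ∀ L t → Valid L → Justified (index L) (length L) t → Valid (L ++ [ t ])
  Valid-snoc L t valid new j j< with j <? length L
  ... | yes j<L = subst (Justified (index (L ++ [ t ])) j) (sym (index-++ˡ L [ t ] j j<L))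
                    (Justified-reindex (valid j j<L) id (λ i i<j → index-++ˡ L [ t ] i (<-trans i<j j<L)) (λ i i<j → i<j))
  ... | no j≮L = subst (λ w → Justified (index (L ++ [ t ])) w (index (L ++ [ t ]) w)) (sym j≡)
                   (subst (Justified (index (L ++ [ t ])) (length L)) (sym (index-snoc L t))
                     (Justified-reindex new id (λ i i< → index-++ˡ L [ t ] i i<) (λ i i< → i<)))
    where
    j≡ : j ≡ length L
    j≡ = ≤-antisym (≤-pred (subst (j <_) (length-snoc L t) j<)) (≮⇒≥ j≮L)

  Contains-++ˡ : ∀ L₁ L₂ {t} → Contains L₁ t → Contains (L₁ ++ L₂) t
  Contains-++ˡ L₁ L₂ (k , k< , at-k) =
    k , <-≤-trans k< (subst (length L₁ ≤_) (sym (length-++ L₁ {L₂})) (m≤m+n _ _)) , trans (index-++ˡ L₁ L₂ k k<) at-k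

  Contains-++ʳ : ∀ L₁ L₂ {t} → Contains L₂ t → Contains (L₁ ++ L₂) t
  Contains-++ʳ L₁ L₂ (k , k< , at-k) =
    length L₁ + k , subst (length L₁ + k <_) (sym (length-++ L₁ {L₂})) (+-monoʳ-< (length L₁) k<) ,
    trans (index-++ʳ L₁ L₂ k) at-k

  certificate-by : ∀ {n} (p : PR n) xs y L → Valid L → Justified (index L) (length L) (line p xs y) → Certificate p xs y
  certificate-by p xs y L valid new =
    L ++ [ t ] , Valid-snoc L t valid new ,
    length L , subst (length L <_) (sym (length-snoc L t)) ≤-refl , index-snoc L t
    where t = line p xs y

  mutual
    certificate-complete : ∀ {n} {p : PR n} {xs y} → Eval p xs y → Certificate p xs y
    certificate-complete {xs = xs} (ev-zero {n}) =
      certificate-by zeroF xs 0 [] Valid-[] (by-zero (lineTag-line (zeroF {n}) xs 0) (lineVal-triple _ _ 0))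
    certificate-complete (ev-succ {x}) = certificate-by succF (x ∷ []) (suc x) [] Valid-[]
      (by-succ (lineTag-line succF _ _) (trans (cong len (lineArgs-triple _ _ _)) (len-encodeVec (x ∷ [])))
               (trans (lineVal-triple _ _ _)
                      (cong suc (sym (trans (cong (λ w → nth w 0) (lineArgs-triple _ _ _)) (nth-cons-zero x 0))))))
    certificate-complete {xs = xs} (ev-proj i) = certificate-by (proj i) xs (lookup xs i) [] Valid-[]
      (by-proj (lineTag-line (proj i) _ _)
               (subst₂ _<_ (sym (lineData-triple 2 (toℕ i) _ _))
                           (sym (trans (cong len (lineArgs-triple _ _ _)) (len-encodeVec xs))) (toℕ<n i))
               (trans (lineVal-triple _ _ _)
                      (sym (trans (cong₂ nth (lineArgs-triple _ _ _) (lineData-triple 2 (toℕ i) _ _)) (nth-encodeVec xs i)))))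
    certificate-complete {xs = xs} (ev-comp {m} {f = f} {gs} {ys = ys} {z} eval-gs eval-f)
      with certificates-complete eval-gs | certificate-complete eval-f
    ... | (L₁ , valid₁ , has-gs) | (L₂ , valid₂ , (k , k< , at-k)) =
      certificate-by (comp f gs) xs z L (Valid-++ L₁ L₂ valid₁ valid₂)
        (by-comp (lineTag-line (comp f gs) _ _) j (subst (j <_) (sym (length-++ L₁ {L₂})) (+-monoʳ-< (length L₁) k<))
                 (trans (cong lineProg at-j) (trans (lineProg-triple _ _ _) (sym prog≡)))
                 (trans (cong lineVal at-j) (trans (lineVal-triple _ _ _) (sym (lineVal-triple _ _ _))))
                 (trans (cong len (trans (cong lineArgs at-j) (lineArgs-triple _ _ _)))
                        (trans (len-encodeVec ys) (sym (trans (cong len gs≡) (len-codeVec gs)))))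
                 has-args)
      where
      L = L₁ ++ L₂
      t = line (comp f gs) xs z
      j = length L₁ + k
      at-j : index L j ≡ line f ys z
      at-j = trans (index-++ʳ L₁ L₂ k) at-k
      prog≡ : unpair₁ (lineData t) ≡ code f
      prog≡ = trans (cong unpair₁ (lineData-triple 3 _ _ _)) (unpair₁-pair _ _)
      gs≡ : unpair₂ (lineData t) ≡ codeVec gs
      gs≡ = trans (cong unpair₂ (lineData-triple 3 _ _ _)) (unpair₂-pair _ _)
      has-args : ∀ i → i < len (unpair₂ (lineData t)) → ∃ λ l → l < length L ×
                 index L l ≡ triple (nth (unpair₂ (lineData t)) i) (lineArgs t) (nth (lineArgs (index L j)) i)
      has-args i i< = l , proj₁ (proj₂ (Contains-++ˡ L₁ L₂ (has-gs fi))) ,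
                      trans (index-++ˡ L₁ L₂ l l<) (trans at-l (sym (cong₃ triple prog-i (lineArgs-triple _ _ _) val-i)))
        where
        i<m : i < m
        i<m = subst (i <_) (trans (cong len gs≡) (len-codeVec gs)) i<
        fi = fromℕ< i<m
        fi≡i : toℕ fi ≡ i
        fi≡i = toℕ-fromℕ< i<m
        l = proj₁ (has-gs fi)
        l< = proj₁ (proj₂ (has-gs fi))
        at-l = proj₂ (proj₂ (has-gs fi))
        prog-i : nth (unpair₂ (lineData t)) i ≡ code (lookup gs fi)
        prog-i = trans (cong₂ nth gs≡ (sym fi≡i)) (nth-codeVec gs fi)
        val-i : nth (lineArgs (index L j)) i ≡ lookup ys fi
        val-i = trans (cong₂ nth (trans (cong lineArgs at-j) (lineArgs-triple _ _ _)) (sym fi≡i)) (nth-encodeVec ys fi)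
    certificate-complete (ev-prec0 {f = f} {g} {xs} {y} eval-f) with certificate-complete eval-f
    ... | (L , valid , (k , k< , at-k)) = certificate-by (prec f g) (0 ∷ xs) y L valid
      (by-prec₀ (lineTag-line (prec f g) _ _) (trans (cong hd (lineArgs-triple _ _ _)) (hd-cons 0 (encodeVec xs))) k k<
                (trans at-k (sym (cong₃ triple (trans (cong unpair₁ (lineData-triple 4 _ _ _)) (unpair₁-pair _ _))
                                               (trans (cong tl (lineArgs-triple _ _ _)) (tl-cons 0 (encodeVec xs)))
                                               (lineVal-triple _ _ _)))))
    certificate-complete (ev-precS {f = f} {g} {xs} {k} {r} {y} eval-prev eval-step)
      with certificate-complete eval-prev | certificate-complete eval-step
    ... | (L₁ , valid₁ , has-prev) | (L₂ , valid₂ , has-step)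
      with Contains-++ˡ L₁ L₂ has-prev | Contains-++ʳ L₁ L₂ has-step
    ... | (j , j< , at-j) | (l , l< , at-l) =
      certificate-by (prec f g) (suc k ∷ xs) y (L₁ ++ L₂) (Valid-++ L₁ L₂ valid₁ valid₂)
        (by-precₛ (lineTag-line (prec f g) _ _) (subst (0 <_) (sym hd≡) (s≤s z≤n)) j j<
                  (trans (cong lineProg at-j) (trans (lineProg-triple _ _ _) (sym (lineProg-triple _ _ _))))
                  (trans (cong lineArgs at-j) (trans (lineArgs-triple _ _ _) (sym (cong₂ cons (cong pred hd≡) tl≡))))
                  l l< (trans at-l (sym (cong₃ triple (trans (cong unpair₂ (lineData-triple 4 _ _ _)) (unpair₂-pair _ _))
                         (cong₂ cons (cong pred hd≡) (cong₂ cons (trans (cong lineVal at-j) (lineVal-triple _ _ _)) tl≡))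
                         (lineVal-triple _ _ _)))))
      where
      t = line (prec f g) (suc k ∷ xs) y
      hd≡ : hd (lineArgs t) ≡ suc k
      hd≡ = trans (cong hd (lineArgs-triple _ _ _)) (hd-cons (suc k) (encodeVec xs))
      tl≡ : tl (lineArgs t) ≡ encodeVec xs
      tl≡ = trans (cong tl (lineArgs-triple _ _ _)) (tl-cons (suc k) (encodeVec xs))
    certificate-complete (ev-mu {f = f} {xs} {y} eval-root below)
      with mu-certificates y below y ≤-refl | certificate-complete eval-root
    ... | (L₁ , valid₁ , has-below) | (L₂ , valid₂ , has-root) with Contains-++ʳ L₁ L₂ has-root
    ... | (j , j< , at-j) =
      certificate-by (mu f) xs y (L₁ ++ L₂) (Valid-++ L₁ L₂ valid₁ valid₂)
        (by-mu (lineTag-line (mu f) _ _) j j<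
               (trans at-j (sym (cong₃ triple (lineData-triple 5 _ _ _)
                                              (cong₂ cons (lineVal-triple _ _ _) (lineArgs-triple _ _ _)) refl)))
               λ w w< → let (v , has-w) = has-below w (subst (w <_) (lineVal-triple _ _ _) w<)
                            (l , l< , at-l) = Contains-++ˡ L₁ L₂ has-w in
                 l , l< , trans (cong lineProg at-l) (trans (lineProg-triple _ _ _) (sym (lineData-triple 5 _ _ _))) ,
                 trans (cong lineArgs at-l) (trans (lineArgs-triple _ _ _) (cong (cons w) (sym (lineArgs-triple _ _ _)))) ,
                 subst (0 <_) (sym (trans (cong lineVal at-l) (lineVal-triple _ _ _))) (s≤s z≤n))

    mu-certificates : ∀ {n} {f : PR (suc n)} {xs : Vec ℕ n} y → (∀ z → z < y → ∃ λ v → Eval f (z ∷ xs) (suc v)) →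
                      ∀ b → b ≤ y → Σ (List ℕ) λ L → Valid L ×
                      (∀ z → z < b → ∃ λ v → Contains L (line f (z ∷ xs) (suc v)))
    mu-certificates y below zero    _  = [] , Valid-[] , λ z ()
    mu-certificates y below (suc b) b< with mu-certificates y below b (≤-trans (n≤1+n b) b<) | below b b<
    ... | (L₁ , valid₁ , has₁) | (v , eval-b) with certificate-complete eval-b
    ... | (L₂ , valid₂ , has₂) = L₁ ++ L₂ , Valid-++ L₁ L₂ valid₁ valid₂ , has
      where
      has : ∀ z → z < suc b → ∃ λ v → Contains (L₁ ++ L₂) _
      has z z< with z <? b
      ... | yes z<b = let (v′ , has-z) = has₁ z z<b in v′ , Contains-++ˡ L₁ L₂ has-z
      ... | no z≮b rewrite ≤-antisym (≤-pred z<) (≮⇒≥ z≮b) = v , Contains-++ʳ L₁ L₂ has₂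

    certificates-complete : ∀ {n m} {gs : Vec (PR n) m} {xs ys} → EvalVec gs xs ys →
                            Σ (List ℕ) λ L → Valid L × (∀ i → Contains L (line (lookup gs i) xs (lookup ys i)))
    certificates-complete evv-[] = [] , Valid-[] , λ ()
    certificates-complete (evv-∷ eval-g eval-gs) with certificate-complete eval-g | certificates-complete eval-gs
    ... | (L₁ , valid₁ , has-g) | (L₂ , valid₂ , has-gs) =
      L₁ ++ L₂ , Valid-++ L₁ L₂ valid₁ valid₂ ,
      λ { zero → Contains-++ˡ L₁ L₂ has-g ; (suc i) → Contains-++ʳ L₁ L₂ (has-gs i) }

  haltsWithin-sound : ∀ (e : PR 1) a s → T (haltsWithin (code e) a s) → ∃ λ v → Eval e (a ∷ []) v
  haltsWithin-sound e a s halts with any<-elim s _ halts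
  ... | (z , _ , ok) with ∧-split (isCertificate z) ok
  ...   | (valid , certified) with any<-elim (len z) _ certified
  ...     | (k , k<len , at-k) =
    lineVal (nth z k) ,
    justified-sound (suc k) (nth z) k ≤-refl all e (a ∷ []) (lineVal (nth z k))
      (trans (sym (triple-lines (nth z k))) (cong₂ (λ c xs → triple c xs (lineVal (nth z k))) (T⇒≡ prog) (T⇒≡ args)))
    where
    prog = proj₁ (∧-split (lineProg (nth z k) ≡ᵇ code e) at-k)
    args = proj₂ (∧-split (lineProg (nth z k) ≡ᵇ code e) at-k)
    all : AllJustified (nth z) k
    all j j≤k = justified?-sound (nth z) j (all<-elim (len z) _ valid j (≤-<-trans j≤k k<len))

  haltsWithin-complete : ∀ (e : PR 1) a v → Eval e (a ∷ []) v → ∃ λ s → T (haltsWithin (code e) a s)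
  haltsWithin-complete e a v eval with certificate-complete eval
  ... | (L , valid , (k , k< , at-k)) =
    suc z , any<-intro (suc z) _ z ≤-refl (∧-intro (isCertificate z) is-certificate certified)
    where
    z = encode L
    is-certificate : T (isCertificate z)
    is-certificate = all<-intro (len z) _ λ j j< → justified?-complete (nth z) j
      (subst (Justified (nth z) j) (sym (nth-encode L j))
             (Justified-reindex (valid j (subst (j <_) (len-encode L) j<)) id (λ i _ → nth-encode L i) (λ i i< → i<)))
    at-k′ : nth z k ≡ line e (a ∷ []) v
    at-k′ = trans (nth-encode L k) at-k
    certified : T (certifies z (code e) a)
    certified = any<-intro (len z) _ k (subst (k <_) (sym (len-encode L)) k<)
      (∧-intro (lineProg (nth z k) ≡ᵇ code e) (≡⇒T (trans (cong lineProg at-k′) (lineProg-triple _ _ _)))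
               (≡⇒T (trans (cong lineArgs at-k′) (lineArgs-triple _ _ _))))

  haltsWithin-mono : ∀ e a s s′ → s ≤ s′ → T (haltsWithin e a s) → T (haltsWithin e a s′)
  haltsWithin-mono e a s s′ s≤s′ halts =
    let (z , z<s₀ , ok) = any<-elim s _ halts in any<-intro s′ _ z (<-≤-trans z<s₀ s≤s′) ok

module BitSets where

  open Representable
  open BoundedSearch
  open import Data.Nat
  open import Data.Nat.Properties
  open import Data.Nat.DivMod using (m/n≡1+[m∸n]/n; [m+n]%n≡m%n)
  open import Data.Bool using ()
  open import Data.Fin using (zero; suc)
  open import Data.Vec using ([]; _∷_; lookup)
  open import Data.Product using (∃; _×_; _,_; proj₁; proj₂)
  open import Data.Empty using (⊥-elim)
  open import Relation.Nullary using (yes; no)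
  open import Relation.Binary.PropositionalEquality
  open import Data.Nat.Tactic.RingSolver using (solve-∀)

  mod2 : ℕ → ℕ
  mod2 zero    = 0
  mod2 (suc s) = 1 ∸ mod2 s

  div2 : ℕ → ℕ
  div2 zero    = 0
  div2 (suc s) = div2 s + mod2 s

  mod2≤1 : ∀ s → mod2 s ≤ 1
  mod2≤1 zero    = z≤n
  mod2≤1 (suc s) = m∸n≤m 1 (mod2 s)

  mod2-suc-suc : ∀ s → mod2 (suc (suc s)) ≡ mod2 s
  mod2-suc-suc s with mod2 s | mod2≤1 s
  ... | zero        | _         = refl
  ... | suc zero    | _         = refl
  ... | suc (suc _) | s≤s ()

  div2-suc-suc : ∀ s → div2 (suc (suc s)) ≡ suc (div2 s)
  div2-suc-suc s with mod2 s | mod2≤1 s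
  ... | zero        | _      = trans (cong (_+ 1) (+-identityʳ _)) (+-comm _ 1)
  ... | suc zero    | _      = trans (+-identityʳ _) (+-comm _ 1)
  ... | suc (suc _) | s≤s ()

  private
    +-2*-suc : ∀ r m → r + 2 * suc m ≡ suc (suc (r + 2 * m))
    +-2*-suc = solve-∀

  mod2+2*div2 : ∀ s → mod2 s + 2 * div2 s ≡ s
  mod2+2*div2 zero          = refl
  mod2+2*div2 (suc zero)    = refl
  mod2+2*div2 (suc (suc s)) rewrite mod2-suc-suc s | div2-suc-suc s | +-2*-suc (mod2 s) (div2 s) =
    cong (λ w → suc (suc w)) (mod2+2*div2 s)

  div2-mod2-of : ∀ r m → r ≤ 1 → div2 (r + 2 * m) ≡ m × mod2 (r + 2 * m) ≡ r
  div2-mod2-of zero       zero    _ = refl , refl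
  div2-mod2-of (suc zero) zero    _ = refl , refl
  div2-mod2-of (suc (suc r)) zero (s≤s ())
  div2-mod2-of r          (suc m) r≤1
    rewrite +-2*-suc r m | div2-suc-suc (r + 2 * m) | mod2-suc-suc (r + 2 * m) =
    cong suc (proj₁ (div2-mod2-of r m r≤1)) , proj₂ (div2-mod2-of r m r≤1)

  /2≡div2 : ∀ s → s / 2 ≡ div2 s
  /2≡div2 zero          = refl
  /2≡div2 (suc zero)    = refl
  /2≡div2 (suc (suc s)) =
    trans (m/n≡1+[m∸n]/n {suc (suc s)} {2} (s≤s (s≤s z≤n))) (trans (cong suc (/2≡div2 s)) (sym (div2-suc-suc s)))

  %2≡mod2 : ∀ s → s % 2 ≡ mod2 s
  %2≡mod2 zero          = refl
  %2≡mod2 (suc zero)    = refl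
  %2≡mod2 (suc (suc s)) =
    trans (trans (cong (_% 2) (+-comm 2 s)) ([m+n]%n≡m%n s 2)) (trans (%2≡mod2 s) (sym (mod2-suc-suc s)))

  bit-zero : ∀ s → bit 0 s ≡ mod2 s
  bit-zero = %2≡mod2

  bit-suc : ∀ i s → bit (suc i) s ≡ bit i (div2 s)
  bit-suc i s = cong (bit i) (/2≡div2 s)

  bit≤1 : ∀ i s → bit i s ≤ 1
  bit≤1 zero    s = subst (_≤ 1) (sym (bit-zero s)) (mod2≤1 s)
  bit≤1 (suc i) s = subst (_≤ 1) (sym (bit-suc i s)) (bit≤1 i (div2 s))

  bit-≢1 : ∀ i s → bit i s ≢ 1 → bit i s ≡ 0
  bit-≢1 i s ≢1 with bit i s | bit≤1 i s
  ... | zero        | _      = refl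
  ... | suc zero    | _      = ⊥-elim (≢1 refl)
  ... | suc (suc _) | s≤s ()

  bit-of-0 : ∀ i → bit i 0 ≡ 0
  bit-of-0 zero    = refl
  bit-of-0 (suc i) = bit-of-0 i

  ∈ₛ⇒< : ∀ {i s} → i ∈ₛ s → i < s
  ∈ₛ⇒< {zero}  {zero}  ()
  ∈ₛ⇒< {zero}  {suc s} _ = s≤s z≤n
  ∈ₛ⇒< {suc i} {s}     i∈s = begin-strict
    suc i            <⟨ m<m*n (suc i) 2 (s≤s (s≤s z≤n)) ⟩
    suc i * 2        ≡⟨ *-comm (suc i) 2 ⟩
    2 * suc i        ≤⟨ *-monoʳ-≤ 2 (∈ₛ⇒< {i} {div2 s} (trans (sym (bit-suc i s)) i∈s)) ⟩
    2 * div2 s       ≤⟨ m≤n+m (2 * div2 s) (mod2 s) ⟩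
    mod2 s + 2 * div2 s ≡⟨ mod2+2*div2 s ⟩
    s                ∎
    where open ≤-Reasoning

  div2< : ∀ s → 0 < s → div2 s < s
  div2< (suc zero)    _ = s≤s z≤n
  div2< (suc (suc s)) _ rewrite div2-suc-suc s = s≤s (s≤s (div2≤ s))
    where
    div2≤ : ∀ s → div2 s ≤ s
    div2≤ zero    = z≤n
    div2≤ (suc s) = subst (div2 s + mod2 s ≤_) (+-comm s 1) (+-mono-≤ (div2≤ s) (mod2≤1 s))

  no-bits⇒0 : ∀ s → (∀ i → bit i s ≡ 0) → s ≡ 0
  no-bits⇒0 s = go (suc s) s ≤-refl
    where
    go : ∀ fuel s → s < fuel → (∀ i → bit i s ≡ 0) → s ≡ 0
    go (suc fuel) zero    _         _    = refl
    go (suc fuel) (suc s) (s≤s s<f) none = begin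
      suc s                          ≡⟨ sym (mod2+2*div2 (suc s)) ⟩
      mod2 (suc s) + 2 * div2 (suc s) ≡⟨ cong₂ (λ p q → p + 2 * q) (trans (sym (bit-zero (suc s))) (none 0)) div2≡0 ⟩
      0                              ∎
      where
      open ≡-Reasoning
      div2≡0 : div2 (suc s) ≡ 0
      div2≡0 = go fuel (div2 (suc s)) (<-≤-trans (div2< (suc s) (s≤s z≤n)) s<f)
                  (λ i → trans (sym (bit-suc i (suc s))) (none (suc i)))

  nonempty-if-pos : ∀ s → 0 < s → ∃ λ i → i ∈ₛ s
  nonempty-if-pos s 0<s with T? (any< s (λ i → bit i s ≡ᵇ 1))
    where open import Data.Bool.Properties using (T?)
  ... | yes t = let (i , _ , i∈s) = any<-elim s _ t in i , T⇒≡ i∈s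
  ... | no ¬t = ⊥-elim (<⇒≢ 0<s (sym (no-bits⇒0 s
                   (λ i → bit-≢1 i s (λ i∈s → ¬t (any<-intro s _ i (∈ₛ⇒< i∈s) (≡⇒T i∈s)))))))

  div2-mod2-+ : ∀ a b → mod2 b ≡ 0 → div2 (a + b) ≡ div2 a + div2 b × mod2 (a + b) ≡ mod2 a
  div2-mod2-+ a b mod2-b =
    subst (λ s → div2 s ≡ div2 a + div2 b × mod2 s ≡ mod2 a) (sym split)
          (div2-mod2-of (mod2 a) (div2 a + div2 b) (mod2≤1 a))
    where
    regroup : ∀ p x z → p + 2 * x + (0 + 2 * z) ≡ p + 2 * (x + z)
    regroup = solve-∀
    split : a + b ≡ mod2 a + 2 * (div2 a + div2 b)
    split = trans (cong₂ _+_ (sym (mod2+2*div2 a))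
                             (trans (sym (mod2+2*div2 b)) (cong (λ p → p + 2 * div2 b) mod2-b)))
                  (regroup (mod2 a) (div2 a) (div2 b))

  -- When a lives below 2^y and b is a multiple of 2^y, adding them is a disjoint union of bit sets.
  bit-+ : ∀ y a b → (∀ i → y ≤ i → bit i a ≡ 0) → (∀ i → i < y → bit i b ≡ 0) →
          ∀ i → bit i (a + b) ≡ bit i a + bit i b
  bit-+ zero a b a-below b-above i
    rewrite no-bits⇒0 a (λ i → a-below i z≤n) | bit-of-0 i = refl
  bit-+ (suc y) a b a-below b-above i with div2-mod2-+ a b (trans (sym (bit-zero b)) (b-above 0 (s≤s z≤n)))
  bit-+ (suc y) a b a-below b-above zero    | (_ , mod2-+) = begin
    bit 0 (a + b)     ≡⟨ trans (bit-zero (a + b)) (trans mod2-+ (sym (bit-zero a))) ⟩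
    bit 0 a           ≡⟨ sym (+-identityʳ _) ⟩
    bit 0 a + 0       ≡⟨ cong (bit 0 a +_) (sym (b-above 0 (s≤s z≤n))) ⟩
    bit 0 a + bit 0 b ∎
    where open ≡-Reasoning
  bit-+ (suc y) a b a-below b-above (suc i) | (div2-+ , _) = begin
    bit (suc i) (a + b)                  ≡⟨ bit-suc i (a + b) ⟩
    bit i (div2 (a + b))                 ≡⟨ cong (bit i) div2-+ ⟩
    bit i (div2 a + div2 b)              ≡⟨ bit-+ y (div2 a) (div2 b)
                                              (λ j y≤j → trans (sym (bit-suc j a)) (a-below (suc j) (s≤s y≤j)))
                                              (λ j j<y → trans (sym (bit-suc j b)) (b-above (suc j) (s≤s j<y))) i ⟩
    bit i (div2 a) + bit i (div2 b)      ≡⟨ sym (cong₂ _+_ (bit-suc i a) (bit-suc i b)) ⟩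
    bit (suc i) a + bit (suc i) b        ∎
    where open ≡-Reasoning

  div2^ : ℕ → ℕ → ℕ
  div2^ zero    s = s
  div2^ (suc i) s = div2 (div2^ i s)

  bit≡mod2-div2^ : ∀ i s → bit i s ≡ mod2 (div2^ i s)
  bit≡mod2-div2^ zero    s = bit-zero s
  bit≡mod2-div2^ (suc i) s = trans (bit-suc i s) (trans (bit≡mod2-div2^ i (div2 s)) (cong mod2 (div2^-suc i s)))
    where
    div2^-suc : ∀ i s → div2^ i (div2 s) ≡ div2^ (suc i) s
    div2^-suc zero    s = refl
    div2^-suc (suc i) s = cong div2 (div2^-suc i s)

  rep-mod2 : ∀ {n f} → Rep n f → Rep n (λ xs → mod2 (f xs))
  rep-mod2 = rep-comp₁ rep-mod2₀
    where
    natrec-mod2 : ∀ s → natrec (λ _ → 0) (λ v → 1 ∸ lookup v (suc zero)) (s ∷ []) ≡ mod2 s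
    natrec-mod2 zero    = refl
    natrec-mod2 (suc s) = cong (1 ∸_) (natrec-mod2 s)
    rep-mod2₀ : Rep 1 (λ v → mod2 (lookup v zero))
    rep-mod2₀ = rep-ext (λ { (s ∷ []) → natrec-mod2 s }) (rep-natrec rep-zero (rep-∸ (rep-const 1) #1))

  rep-bit : ∀ {n f g} → Rep n f → Rep n g → Rep n (λ xs → bit (f xs) (g xs))
  rep-bit {f = f} {g} rf rg =
    rep-ext (λ xs → sym (bit≡mod2-div2^ (f xs) (g xs))) (rep-mod2 (rep-comp₂ rep-div2^ rf rg))
    where
    natrec-div2 : ∀ s → natrec (λ _ → 0) (λ v → lookup v (suc zero) + mod2 (lookup v zero)) (s ∷ []) ≡ div2 s
    natrec-div2 zero    = refl
    natrec-div2 (suc s) = cong (_+ mod2 s) (natrec-div2 s)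
    rep-div2 : Rep 1 (λ v → div2 (lookup v zero))
    rep-div2 = rep-ext (λ { (s ∷ []) → natrec-div2 s }) (rep-natrec rep-zero (rep-+ #1 (rep-mod2 #0)))
    natrec-div2^ : ∀ i s → natrec (λ v → lookup v zero) (λ v → div2 (lookup v (suc zero))) (i ∷ s ∷ [])
                           ≡ div2^ i s
    natrec-div2^ zero    s = refl
    natrec-div2^ (suc i) s = cong div2 (natrec-div2^ i s)
    rep-div2^ : Rep 2 (λ v → div2^ (lookup v zero) (lookup v (suc zero)))
    rep-div2^ = rep-ext (λ { (i ∷ s ∷ []) → natrec-div2^ i s }) (rep-natrec #0 (rep-comp₁ rep-div2 #1))

  least-element : ∀ s → 0 < s → ∃ λ y → y ∈ₛ s × (∀ i → i < y → bit i s ≡ 0)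
  least-element s 0<s with nonempty-if-pos s 0<s
  ... | (i , i∈s) with min<-spec s (λ j → bit j s ≡ᵇ 1) (any<-intro s _ i (∈ₛ⇒< i∈s) (≡⇒T i∈s))
  ...   | (_ , y∈s , least) = _ , T⇒≡ y∈s , λ j j<y → bit-≢1 j s (λ j∈s → least j j<y (≡⇒T j∈s))

  mod2-cancelˡ : ∀ m n → mod2 m ≡ mod2 (m + n) → mod2 n ≡ 0
  mod2-cancelˡ zero    n eq = sym eq
  mod2-cancelˡ (suc m) n eq = mod2-cancelˡ m n (1∸-injective (mod2≤1 m) (mod2≤1 (m + n)) eq)
    where
    1∸-injective : ∀ {x y} → x ≤ 1 → y ≤ 1 → 1 ∸ x ≡ 1 ∸ y → x ≡ y
    1∸-injective {0}           {0}           _        _        _  = refl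
    1∸-injective {1}           {1}           _        _        _  = refl
    1∸-injective {0}           {1}           _        _        ()
    1∸-injective {1}           {0}           _        _        ()
    1∸-injective {suc (suc _)} {_}           (s≤s ()) _        _
    1∸-injective {_}           {suc (suc _)} _        (s≤s ()) _

module Colourings where

  open Representable
  open BoundedSearch
  open BitSets
  open import Data.Nat
  open import Data.Nat.Properties
  open import Data.Bool using (Bool; true; false; _∧_; if_then_else_; T)
  open import Data.Fin using (zero; suc)
  open import Data.Vec using ([]; _∷_; lookup)
  open import Data.Product using (_×_; _,_)
  open import Data.Sum using (inj₁; inj₂)
  open import Data.Empty using (⊥-elim)
  open import Relation.Binary.PropositionalEquality
  open import Relation.Binary.Definitions using (tri<; tri≈; tri>)

  -- One more than the largest element of s below q, and 0 if there is none.
  topBelow : ℕ → ℕ → ℕ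
  topBelow s zero    = 0
  topBelow s (suc q) = if bit q s ≡ᵇ 1 then suc q else topBelow s q

  maxElem : ℕ → ℕ
  maxElem s = pred (topBelow s s)

  topBelow-local : ∀ s s′ q → (∀ i → i < q → bit i s ≡ bit i s′) → topBelow s q ≡ topBelow s′ q
  topBelow-local s s′ zero    agree = refl
  topBelow-local s s′ (suc q) agree
    rewrite agree q ≤-refl | topBelow-local s s′ q (λ i i<q → agree i (m<n⇒m<1+n i<q)) = refl

  topBelow-empty : ∀ s q → (∀ i → i < q → bit i s ≡ 0) → topBelow s q ≡ 0
  topBelow-empty s zero    none = refl
  topBelow-empty s (suc q) none rewrite none q ≤-refl = topBelow-empty s q (λ i i<q → none i (m<n⇒m<1+n i<q))

  topBelow-agree-above : ∀ s s′ y q → y < q → y ∈ₛ s → y ∈ₛ s′ →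
                         (∀ i → y ≤ i → i < q → bit i s ≡ bit i s′) → topBelow s q ≡ topBelow s′ q
  topBelow-agree-above s s′ y (suc q) (s≤s y≤q) y∈s y∈s′ agree
    rewrite agree q y≤q ≤-refl with bit q s′ ≡ᵇ 1 in eq
  ... | true  = refl
  ... | false with m≤n⇒m<n∨m≡n y≤q
  ...   | inj₁ y<q  = topBelow-agree-above s s′ y q y<q y∈s y∈s′ (λ i y≤i i<q → agree i y≤i (m<n⇒m<1+n i<q))
  ...   | inj₂ refl = ⊥-elim (subst T eq (≡⇒T y∈s′))

  topBelow-stable : ∀ s q q′ → (∀ i → q ≤ i → bit i s ≡ 0) → q ≤ q′ → topBelow s q′ ≡ topBelow s q
  topBelow-stable s q zero     none z≤n = refl
  topBelow-stable s q (suc q′) none q≤ with m≤n⇒m<n∨m≡n q≤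
  ... | inj₂ refl  = refl
  ... | inj₁ q<1+q′ rewrite none q′ (≤-pred q<1+q′) = topBelow-stable s q q′ none (≤-pred q<1+q′)

  topBelow-pos : ∀ s q i → i < q → i ∈ₛ s → 0 < topBelow s q
  topBelow-pos s (suc q) i (s≤s i≤q) i∈s with bit q s ≡ᵇ 1 in eq
  ... | true  = s≤s z≤n
  ... | false with m≤n⇒m<n∨m≡n i≤q
  ...   | inj₁ i<q  = topBelow-pos s q i i<q i∈s
  ...   | inj₂ refl = ⊥-elim (subst T eq (≡⇒T i∈s))

  topBelow-∈ : ∀ s q m → topBelow s q ≡ suc m → m ∈ₛ s × m < q
  topBelow-∈ s (suc q) m eq with bit q s ≡ᵇ 1 in q∈s
  ... | true rewrite suc-injective eq = T⇒≡ (subst T (sym q∈s) _) , ≤-refl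
  ... | false = let (m∈s , m<q) = topBelow-∈ s q m eq in m∈s , m<n⇒m<1+n m<q

  topBelow-beyond : ∀ s y → (∀ i → y ≤ i → bit i s ≡ 0) → topBelow s y ≡ topBelow s s
  topBelow-beyond s y none-above with ≤-total y s
  ... | inj₁ y≤s = sym (topBelow-stable s y s none-above y≤s)
  ... | inj₂ s≤y = topBelow-stable s s y (λ i s≤i → bit-≢1 i s (λ i∈s → <⇒≱ (∈ₛ⇒< i∈s) s≤i)) s≤y

  maxElem-∈ : ∀ s → 0 < s → maxElem s ∈ₛ s × maxElem s < s
  maxElem-∈ s 0<s with nonempty-if-pos s 0<s
  ... | (i , i∈s) with topBelow s s | topBelow-pos s s i (∈ₛ⇒< i∈s) i∈s | topBelow-∈ s s
  ...   | suc m | _ | top-∈ = top-∈ m refl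

  rep-topBelow : ∀ {n fs fq} → Rep n fs → Rep n fq → Rep n (λ xs → topBelow (fs xs) (fq xs))
  rep-topBelow rs rq = rep-comp₂ rep-topBelow₀ rq rs
    where
    step : ℕ → ℕ → ℕ → ℕ
    step q r s = if bit q s ≡ᵇ 1 then suc q else r
    natrec-topBelow : ∀ q s → natrec (λ _ → 0)
                                     (λ v → step (lookup v zero) (lookup v (suc zero)) (lookup v (suc (suc zero))))
                                     (q ∷ s ∷ []) ≡ topBelow s q
    natrec-topBelow zero    s = refl
    natrec-topBelow (suc q) s rewrite natrec-topBelow q s = refl
    rep-topBelow₀ : Rep 2 (λ v → topBelow (lookup v (suc zero)) (lookup v zero))
    rep-topBelow₀ = rep-ext (λ { (q ∷ s ∷ []) → natrec-topBelow q s })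
      (rep-natrec rep-zero (rep-if (repB-≡ᵇ (rep-bit #0 #2) (rep-const 1)) (rep-suc #0) #1))

  rep-maxElem : ∀ {n f} → Rep n f → Rep n (λ xs → maxElem (f xs))
  rep-maxElem r = rep-pred (rep-topBelow r r)

  -- J p q marks the consecutive pair p < q; the colour of s is the parity of its marked consecutive pairs.
  module ColouringBy (J : ℕ → ℕ → Bool) where

    markAt : ℕ → ℕ → ℕ
    markAt s q = if (bit q s ≡ᵇ 1) ∧ (0 <ᵇ topBelow s q) then boolToℕ (J (pred (topBelow s q)) q) else 0

    marks : ℕ → ℕ
    marks s = sum< s (markAt s)

    colour : ℕ → ℕ
    colour s = mod2 (marks s)

    markAt-∉ : ∀ s q → bit q s ≡ 0 → markAt s q ≡ 0
    markAt-∉ s q q∉s rewrite q∉s = refl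

    markAt-beyond : ∀ s q → s ≤ q → markAt s q ≡ 0
    markAt-beyond s q s≤q = markAt-∉ s q (bit-≢1 q s (λ q∈s → <⇒≱ (∈ₛ⇒< q∈s) s≤q))

    rep-colour : RepB 2 (λ v → J (lookup v zero) (lookup v (suc zero))) → Rep 1 (λ v → colour (lookup v zero))
    rep-colour rep-J = rep-mod2 (rep-sum< #0 rep-markAt)
      where
      rep-markAt : Rep 2 (λ v → markAt (lookup v (suc zero)) (lookup v zero))
      rep-markAt = rep-if (repB-∧ (repB-≡ᵇ (rep-bit #0 #1) (rep-const 1)) (repB-<ᵇ (rep-const 0) (rep-topBelow #1 #0)))
                          (rep-comp₂ rep-J (rep-pred (rep-topBelow #1 #0)) #0) (rep-const 0)

    -- Joining a below y to b starting at y creates exactly one new consecutive pair: (maxElem a , y).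
    marks-join : ∀ a b y → 0 < a → (∀ i → y ≤ i → bit i a ≡ 0) → (∀ i → i < y → bit i b ≡ 0) → y ∈ₛ b →
                 marks (a + b) ≡ marks a + marks b + boolToℕ (J (maxElem a) y)
    marks-join a b y 0<a a-below b-above y∈b = begin
      sum< (a + b) (markAt (a + b))
        ≡⟨ sum<-cong (a + b) _ _ (λ q _ → pointwise q) ⟩
      sum< (a + b) (λ q → markAt a q + markAt b q + new q)
        ≡⟨ sum<-+ (a + b) (λ q → markAt a q + markAt b q) new ⟩
      sum< (a + b) (λ q → markAt a q + markAt b q) + sum< (a + b) new
        ≡⟨ cong₂ _+_ (sum<-+ (a + b) (markAt a) (markAt b)) (sum<-point (a + b) y jump y<a+b) ⟩
      sum< (a + b) (markAt a) + sum< (a + b) (markAt b) + jump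
        ≡⟨ cong (_+ jump) (cong₂ _+_ (sum<-vanish a (a + b) (markAt a) (markAt-beyond a) (m≤m+n a b))
                                     (sum<-vanish b (a + b) (markAt b) (markAt-beyond b) (m≤n+m b a))) ⟩
      marks a + marks b + jump
        ∎
      where
      open ≡-Reasoning
      jump : ℕ
      jump = boolToℕ (J (maxElem a) y)
      new : ℕ → ℕ
      new q = if q ≡ᵇ y then jump else 0
      y<a+b : y < a + b
      y<a+b = <-≤-trans (∈ₛ⇒< y∈b) (m≤n+m b a)
      bit-join : ∀ i → bit i (a + b) ≡ bit i a + bit i b
      bit-join = bit-+ y a b a-below b-above
      bit-join-below : ∀ i → i < y → bit i (a + b) ≡ bit i a
      bit-join-below i i<y = trans (bit-join i) (trans (cong (bit i a +_) (b-above i i<y)) (+-identityʳ _))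
      topBelow-join-below : ∀ q → q ≤ y → topBelow (a + b) q ≡ topBelow a q
      topBelow-join-below q q≤y = topBelow-local (a + b) a q (λ i i<q → bit-join-below i (<-≤-trans i<q q≤y))
      a-top : 0 < topBelow a y
      a-top = let (m∈a , _) = maxElem-∈ a 0<a in
              topBelow-pos a y (maxElem a) (≰⇒> (λ y≤m → 0≢1+n (trans (sym (a-below _ y≤m)) m∈a))) m∈a
      y∈a+b : y ∈ₛ (a + b)
      y∈a+b = trans (bit-join y) (cong₂ _+_ (a-below y ≤-refl) y∈b)
      pointwise : ∀ q → markAt (a + b) q ≡ markAt a q + markAt b q + new q
      pointwise q with <-cmp q y
      ... | tri< q<y _ _ rewrite bit-join-below q q<y | topBelow-join-below q (<⇒≤ q<y)
                               | markAt-∉ b q (b-above q q<y) | ≢⇒≡ᵇ-false (<⇒≢ q<y) =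
        sym (trans (+-identityʳ _) (+-identityʳ _))
      ... | tri≈ _ refl _ rewrite bit-join y | a-below y ≤-refl | y∈b | topBelow-join-below y ≤-refl
                                | <⇒<ᵇ-true a-top | topBelow-empty b y b-above | ≡ᵇ-refl y
                                | topBelow-beyond a y a-below = refl
      ... | tri> _ _ y<q rewrite bit-join q | a-below q (<⇒≤ y<q)
                               | topBelow-agree-above (a + b) b y q y<q y∈a+b y∈b
                                   (λ i y≤i _ → trans (bit-join i) (cong (_+ bit i b) (a-below i y≤i)))
                               | ≢⇒≡ᵇ-false (>⇒≢ y<q) = sym (+-identityʳ _)

module Construction where

  open Representable
  open BoundedSearch
  open ListCodes
  open Certificates
  open BitSets
  open Colourings
  open import Data.Nat
  open import Data.Nat.Properties
  open import Data.Bool using (Bool; true; false; _∧_; not; if_then_else_; T)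
  open import Data.Bool.Properties using (T?)
  open import Data.Fin using (zero; suc)
  open import Data.Vec using ([]; _∷_; lookup)
  open import Data.Product using (_×_; _,_; proj₁; proj₂)
  open import Data.Sum using (inj₁; inj₂)
  open import Data.Empty using (⊥-elim)
  open import Relation.Nullary using (¬_; yes; no)
  open import Relation.Binary.PropositionalEquality
  open import Relation.Binary.Definitions using (tri<; tri≈; tri>)

  enumerated : ℕ → ℕ → ℕ → Bool
  enumerated e y p = any< y (λ a → (0 <ᵇ a) ∧ ((maxElem a ≡ᵇ p) ∧ haltsWithin e a y))

  inList : ℕ → ℕ → Bool
  inList p U = any< (len U) (λ i → nth U i ≡ᵇ p)

  available : ℕ → ℕ → ℕ → ℕ → Bool
  available e y U p = enumerated e y p ∧ not (inList p U)

  firstPick : ℕ → ℕ → ℕ → ℕ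
  firstPick e y U = min< y (available e y U)

  secondPick : ℕ → ℕ → ℕ → ℕ
  secondPick e y U = min< y (λ p → (firstPick e y U <ᵇ p) ∧ available e y U p)

  acts : ℕ → ℕ → ℕ → Bool
  acts e y U = secondPick e y U <ᵇ y

  claim : ℕ → ℕ → ℕ → ℕ
  claim e y U = if acts e y U then cons (firstPick e y U) (cons (secondPick e y U) U) else U

  used : ℕ → ℕ → ℕ
  used zero    y = 0
  used (suc e) y = claim e y (used e y)

  marked : ℕ → ℕ → Bool
  marked p y = any< y (λ e → acts e y (used e y) ∧ (secondPick e y (used e y) ≡ᵇ p))

  rep-marked : RepB 2 (λ v → marked (lookup v zero) (lookup v (suc zero)))
  rep-marked =
    repB-any< #1 (repB-∧ (rep-comp₃ rep-acts #0 #2 rep-used′) (repB-≡ᵇ (rep-comp₃ rep-secondPick #0 #2 rep-used′) #1))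
    where
    rep-available : ∀ {n fe fy fU fp} → Rep n fe → Rep n fy → Rep n fU → Rep n fp →
                    RepB n (λ xs → available (fe xs) (fy xs) (fU xs) (fp xs))
    rep-available = rep-comp₄ (repB-∧ (rep-comp₃ rep-enumerated #0 #1 #3) (repB-not (rep-comp₂ rep-inList #3 #2)))
      where
      rep-enumerated : RepB 3 (λ v → enumerated (lookup v zero) (lookup v (suc zero)) (lookup v (suc (suc zero))))
      rep-enumerated = repB-any< #1 (repB-∧ (repB-<ᵇ (rep-const 0) #0)
                                    (repB-∧ (repB-≡ᵇ (rep-maxElem #0) #3) (repB-haltsWithin #1 #0 #2)))
      rep-inList : RepB 2 (λ v → inList (lookup v zero) (lookup v (suc zero)))
      rep-inList = repB-any< (rep-len #1) (repB-≡ᵇ (rep-nth #2 #0) #1)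
    rep-firstPick : Rep 3 (λ v → firstPick (lookup v zero) (lookup v (suc zero)) (lookup v (suc (suc zero))))
    rep-firstPick = rep-min< #1 (rep-available #1 #2 #3 #0)
    rep-secondPick : Rep 3 (λ v → secondPick (lookup v zero) (lookup v (suc zero)) (lookup v (suc (suc zero))))
    rep-secondPick = rep-min< #1 (repB-∧ (repB-<ᵇ (rep-comp₃ rep-firstPick #1 #2 #3) #0) (rep-available #1 #2 #3 #0))
    rep-acts : RepB 3 (λ v → acts (lookup v zero) (lookup v (suc zero)) (lookup v (suc (suc zero))))
    rep-acts = repB-<ᵇ rep-secondPick #1
    rep-used : Rep 2 (λ v → used (lookup v zero) (lookup v (suc zero)))
    rep-used = rep-ext (λ { (e ∷ y ∷ []) → natrec-used e y })
                       (rep-natrec rep-zero (rep-comp₃ rep-claim #0 #2 #1))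
      where
      rep-claim : Rep 3 (λ v → claim (lookup v zero) (lookup v (suc zero)) (lookup v (suc (suc zero))))
      rep-claim = rep-if rep-acts (rep-cons rep-firstPick (rep-cons rep-secondPick #2)) #2
      natrec-used : ∀ e y → natrec (λ _ → 0)
                                   (λ v → claim (lookup v zero) (lookup v (suc (suc zero))) (lookup v (suc zero)))
                                   (e ∷ y ∷ []) ≡ used e y
      natrec-used zero    y = refl
      natrec-used (suc e) y = cong (claim e y) (natrec-used e y)
    rep-used′ : Rep 3 (λ v → used (lookup v zero) (lookup v (suc (suc zero))))
    rep-used′ = rep-comp₂ rep-used #0 #2

  enumerated-< : ∀ e y p → T (enumerated e y p) → p < y
  enumerated-< e y p t with any<-elim y _ t
  ... | (a , a<y , h) = subst (_< y) (T⇒≡ (∧-fst (maxElem a ≡ᵇ p) (∧-snd (0 <ᵇ a) h)))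
                               (<-trans (proj₂ (maxElem-∈ a (T⇒< (∧-fst (0 <ᵇ a) h)))) a<y)

  available-< : ∀ e y U p → T (available e y U p) → p < y
  available-< e y U p t = enumerated-< e y p (∧-fst (enumerated e y p) t)

  firstPick-least : ∀ e y U p → T (available e y U p) → firstPick e y U ≤ p
  firstPick-least e y U p t =
    ≮⇒≥ (λ p<first → proj₂ (proj₂ (min<-spec y _ (any<-intro y _ p (available-< e y U p t) t))) p p<first t)

  acts-picks : ∀ e y U → T (acts e y U) →
               T (available e y U (firstPick e y U)) × T (available e y U (secondPick e y U)) ×
               firstPick e y U < secondPick e y U
  acts-picks e y U acting = first-available , ∧-snd (first <ᵇ second) second-ok , first<second
    where
    first = firstPick e y U
    second = secondPick e y U
    second<y : second < y
    second<y = T⇒< acting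
    second-exists : T (any< y (λ p → (first <ᵇ p) ∧ available e y U p))
    second-exists with T? (any< y (λ p → (first <ᵇ p) ∧ available e y U p))
    ... | yes found = found
    ... | no none   = ⊥-elim (<-irrefl (min<-none y _ none) second<y)
    second-ok : T ((first <ᵇ second) ∧ available e y U second)
    second-ok = proj₁ (proj₂ (min<-spec y _ second-exists))
    first<second : first < second
    first<second = T⇒< (∧-fst (first <ᵇ second) second-ok)
    first-available : T (available e y U first)
    first-available with T? (any< y (available e y U))
    ... | yes found = proj₁ (proj₂ (min<-spec y _ found))
    ... | no none   = ⊥-elim (<-irrefl (min<-none y _ none) (<-trans first<second second<y))

  available-idle : ∀ e y U p → ¬ T (acts e y U) → T (available e y U p) → p ≡ firstPick e y U
  available-idle e y U p idle avail with m≤n⇒m<n∨m≡n (firstPick-least e y U p avail)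
  ... | inj₂ first≡p  = sym first≡p
  ... | inj₁ first<p = ⊥-elim (idle (<⇒T (≤-<-trans second≤p (available-< e y U p avail))))
    where
    second≤p : secondPick e y U ≤ p
    second≤p = ≮⇒≥ (λ p<second → proj₂ (proj₂ (min<-spec y _ (any<-intro y _ p (available-< e y U p avail)
                                      (∧-intro (firstPick e y U <ᵇ p) (<⇒T first<p) avail)))) p p<second
                                      (∧-intro (firstPick e y U <ᵇ p) (<⇒T first<p) avail))

  available-∉ : ∀ e y U p → T (available e y U p) → ¬ T (inList p U)
  available-∉ e y U p avail = T-not⇒¬T (∧-snd (enumerated e y p) avail)

  inList-here : ∀ x U → T (inList x (cons x U))
  inList-here x U = any<-intro (len (cons x U)) _ 0 (subst (0 <_) (sym (len-cons x U)) (s≤s z≤n))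
                               (≡⇒T (nth-cons-zero x U))

  inList-there : ∀ p x U → T (inList p U) → T (inList p (cons x U))
  inList-there p x U p∈U with any<-elim (len U) _ p∈U
  ... | (i , i<len , at-i) = any<-intro (len (cons x U)) _ (suc i) (subst (suc i <_) (sym (len-cons x U)) (s≤s i<len))
                                        (subst (λ w → T (w ≡ᵇ p)) (sym (nth-cons-suc x U i)) at-i)

  positionIn : ℕ → ℕ → ℕ
  positionIn p U = min< (len U) (λ i → nth U i ≡ᵇ p)

  positionIn-spec : ∀ p U → T (inList p U) → positionIn p U < len U × nth U (positionIn p U) ≡ p
  positionIn-spec p U p∈U = let (pos<len , at-pos , _) = min<-spec (len U) _ p∈U in pos<len , T⇒≡ at-pos

  used-mono : ∀ p e e′ y → e ≤ e′ → T (inList p (used e y)) → T (inList p (used e′ y))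
  used-mono p e zero     y z≤n p∈U = p∈U
  used-mono p e (suc e′) y e≤ p∈U with m≤n⇒m<n∨m≡n e≤
  ... | inj₂ refl  = p∈U
  ... | inj₁ e<1+e′ with acts e′ y (used e′ y)
  ...   | true  = inList-there p _ _ (inList-there p _ _ (used-mono p e e′ y (≤-pred e<1+e′) p∈U))
  ...   | false = used-mono p e e′ y (≤-pred e<1+e′) p∈U

  claimed : ∀ e y → T (acts e y (used e y)) →
            T (inList (firstPick e y (used e y)) (used (suc e) y)) × T (inList (secondPick e y (used e y)) (used (suc e) y))
  claimed e y acting with acts e y (used e y)
  ... | true = inList-here _ _ , inList-there _ _ _ (inList-here _ _)

  len-used : ∀ e y → len (used e y) ≤ 2 * e
  len-used zero    y = subst (_≤ 0) (sym (len-encode [])) z≤n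
    where open import Data.List using ([])
  len-used (suc e) y with acts e y (used e y)
  ... | true  = begin
    len (cons _ (cons _ (used e y))) ≡⟨ trans (len-cons _ _) (cong suc (len-cons _ _)) ⟩
    2 + len (used e y)               ≤⟨ +-monoʳ-≤ 2 (len-used e y) ⟩
    2 + 2 * e                        ≡⟨ sym (*-distribˡ-+ 2 1 e) ⟩
    2 * suc e                        ∎
    where open ≤-Reasoning
  ... | false = ≤-trans (len-used e y) (*-monoʳ-≤ 2 (n≤1+n e))

  marked-secondPick : ∀ e y → e < y → T (acts e y (used e y)) → T (marked (secondPick e y (used e y)) y)
  marked-secondPick e y e<y acting =
    any<-intro y _ e e<y (∧-intro (acts e y (used e y)) acting (≡⇒T {secondPick e y (used e y)} refl))

  -- A point claimed first by one program is never claimed second by another, since claims are fresh.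
  unmarked-firstPick : ∀ e y → T (acts e y (used e y)) → ¬ T (marked (firstPick e y (used e y)) y)
  unmarked-firstPick e y acting is-marked with any<-elim y _ is-marked
  ... | (e′ , _ , h)
    with acts-picks e y (used e y) acting | acts-picks e′ y (used e′ y) (∧-fst (acts e′ y (used e′ y)) h)
  ...   | (first-avail , _ , first<second) | (_ , second′-avail , _)
    with T⇒≡ (∧-snd (acts e′ y (used e′ y)) h) | <-cmp e′ e
  ...     | second′≡first | tri≈ _ refl _ = <-irrefl (sym second′≡first) first<second
  ...     | second′≡first | tri< e′<e _ _ =
    available-∉ e y (used e y) (firstPick e y (used e y)) first-avail
      (subst (λ p → T (inList p (used e y))) second′≡first
             (used-mono _ (suc e′) e y e′<e (proj₂ (claimed e′ y (∧-fst (acts e′ y (used e′ y)) h)))))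
  ...     | second′≡first | tri> _ _ e<e′ =
    available-∉ e′ y (used e′ y) (secondPick e′ y (used e′ y)) second′-avail
      (subst (λ p → T (inList p (used e′ y))) (sym second′≡first)
             (used-mono _ (suc e) e′ y e<e′ (proj₁ (claimed e y acting))))

open Representable
open BoundedSearch
open ListCodes
open Certificates
open BitSets
open Colourings
open Construction
open import Data.Nat
open import Data.Nat.Properties
open import Data.Bool using (Bool; true; _∧_; not; if_then_else_; T)
open import Data.Bool.Properties using (T?)
open import Data.Fin using (toℕ; fromℕ<)
open import Data.Fin.Properties using (toℕ-fromℕ<; toℕ<n; pigeonhole)
open import Data.Vec using ([]; _∷_)
open import Data.List using ([]; _∷_)
open import Data.List.Relation.Unary.Any using (here; there)
open import Data.List.Membership.Propositional using (_∈_)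
open import Data.Product using (Σ; ∃; _×_; _,_; proj₁; proj₂)
open import Data.Sum using (_⊎_; inj₁; inj₂)
open import Data.Empty using (⊥; ⊥-elim)
open import Relation.Nullary using (¬_; yes; no)
open import Relation.Binary.PropositionalEquality
open import Function.Bundles using (_⇔_; Equivalence; mk⇔)

no-injection : ∀ K M → M < K → (g : ℕ → ℕ) → (∀ k → k < K → g k < M) →
               (∀ i j → i < j → j < K → g i ≢ g j) → ⊥
no-injection K M M<K g bound distinct
  with pigeonhole M<K (λ i → fromℕ< (bound (toℕ i) (toℕ<n i)))
... | (i , j , i<j , same) = distinct (toℕ i) (toℕ j) i<j (toℕ<n j)
  (trans (sym (toℕ-fromℕ< (bound (toℕ i) (toℕ<n i))))
         (trans (cong toℕ same) (toℕ-fromℕ< (bound (toℕ j) (toℕ<n j)))))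

distinct-labels-bound : ∀ K M (F label : ℕ → ℕ) →
  (∀ j k → j < k → k < K → F j ≢ F k) →
  (∀ k → k < K → 0 < F k → label k < M) →
  (∀ j k → j < k → k < K → 0 < F j → 0 < F k → label j ≢ label k) →
  K ≤ suc M
distinct-labels-bound K M F label F-distinct label-bound label-distinct =
  ≮⇒≥ (λ 1+M<K → no-injection K (suc M) 1+M<K slot slot-bound slot-distinct)
  where
  slot : ℕ → ℕ
  slot k = if F k ≡ᵇ 0 then M else label k
  slot-bound : ∀ k → k < K → slot k < suc M
  slot-bound k k<K with F k in eq
  ... | zero  = ≤-refl
  ... | suc _ = m<n⇒m<1+n (label-bound k k<K (subst (0 <_) (sym eq) (s≤s z≤n)))
  slot-distinct : ∀ i j → i < j → j < K → slot i ≢ slot j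
  slot-distinct i j i<j j<K same with F i in eqi | F j in eqj
  ... | zero  | zero  = F-distinct i j i<j j<K (trans eqi (sym eqj))
  ... | zero  | suc _ = <-irrefl (sym same) (label-bound j j<K (subst (0 <_) (sym eqj) (s≤s z≤n)))
  ... | suc _ | zero  = <-irrefl same (label-bound i (<-trans i<j j<K) (subst (0 <_) (sym eqi) (s≤s z≤n)))
  ... | suc _ | suc _ =
    label-distinct i j i<j j<K (subst (0 <_) (sym eqi) (s≤s z≤n)) (subst (0 <_) (sym eqj) (s≤s z≤n)) same

-- Not acting leaves at most one fresh point, so all but one of the 2e + 3 sets would have their
-- maxima among the at most 2e + 1 points of firstPick ∷ used.
acts-if-enumerated : ∀ e y (F : ℕ → ℕ) →
  (∀ k → k < 3 + 2 * e → 0 < F k → T (enumerated e y (maxElem (F k)))) →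
  (∀ j k → j < k → k < 3 + 2 * e → F j ≢ F k) →
  (∀ j k → j < k → k < 3 + 2 * e → 0 < F j → 0 < F k → maxElem (F j) ≢ maxElem (F k)) →
  T (acts e y (used e y))
acts-if-enumerated e y F enum F-distinct max-distinct with T? (acts e y (used e y))
... | yes acting = acting
... | no idle    =
  ⊥-elim (1+n≰n (distinct-labels-bound (3 + 2 * e) (1 + 2 * e) F label F-distinct label-bound label-distinct))
  where
  U = used e y
  V = cons (firstPick e y U) U
  label : ℕ → ℕ
  label k = positionIn (maxElem (F k)) V
  in-V : ∀ k → k < 3 + 2 * e → 0 < F k → T (inList (maxElem (F k)) V)
  in-V k k<K pos with T? (inList (maxElem (F k)) U)
  ... | yes in-U = inList-there _ _ U in-U
  ... | no ∉U = subst (λ p → T (inList p V))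
                      (sym (available-idle e y U _ idle (∧-intro (enumerated e y _) (enum k k<K pos) (¬T⇒T-not ∉U))))
                      (inList-here _ U)
  label-bound : ∀ k → k < 3 + 2 * e → 0 < F k → label k < 1 + 2 * e
  label-bound k k<K pos = <-≤-trans (proj₁ (positionIn-spec _ V (in-V k k<K pos)))
                                    (≤-trans (≤-reflexive (len-cons _ U)) (s≤s (len-used e y)))
  label-distinct : ∀ j k → j < k → k < 3 + 2 * e → 0 < F j → 0 < F k → label j ≢ label k
  label-distinct j k j<k k<K posj posk same = max-distinct j k j<k k<K posj posk (begin
    maxElem (F j)     ≡⟨ sym (proj₂ (positionIn-spec _ V (in-V j (<-trans j<k k<K) posj))) ⟩
    nth V (label j)   ≡⟨ cong (nth V) same ⟩
    nth V (label k)   ≡⟨ proj₂ (positionIn-spec _ V (in-V k k<K posk)) ⟩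
    maxElem (F k)     ∎)
    where open ≡-Reasoning

member-beyond : ∀ y (F : ℕ → ℕ) → (∀ j k → j < k → F j ≢ F k) →
                (∀ j k → j < k → ∀ i → i ∈ₛ F j → ¬ i ∈ₛ F k) →
                ∃ λ k → 0 < F k × (∀ i → i < y → bit i (F k) ≡ 0)
member-beyond y F F-distinct F-disjoint with T? (any< (2 + y) beyond)
  where
  beyond : ℕ → Bool
  beyond k = (0 <ᵇ F k) ∧ not (any< y (λ i → bit i (F k) ≡ᵇ 1))
... | yes found = let (k , _ , k-beyond) = any<-elim (2 + y) _ found in
  k , T⇒< (∧-fst (0 <ᵇ F k) k-beyond) ,
  λ i i<y → bit-≢1 i (F k) (λ i∈F → T-not⇒¬T (∧-snd (0 <ᵇ F k) k-beyond) (any<-intro y _ i i<y (≡⇒T i∈F)))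
... | no none = ⊥-elim (1+n≰n (distinct-labels-bound (2 + y) y F least
                                 (λ j k j<k _ → F-distinct j k j<k) least-bound least-distinct))
  where
  least : ℕ → ℕ
  least k = min< y (λ i → bit i (F k) ≡ᵇ 1)
  early : ∀ k → k < 2 + y → 0 < F k → T (any< y (λ i → bit i (F k) ≡ᵇ 1))
  early k k< pos with T? (any< y (λ i → bit i (F k) ≡ᵇ 1))
  ... | yes some = some
  ... | no ¬some = ⊥-elim (none (any<-intro (2 + y) _ k k< (∧-intro (0 <ᵇ F k) (<⇒T pos) (¬T⇒T-not ¬some))))
  least-spec : ∀ k → k < 2 + y → 0 < F k → least k < y × least k ∈ₛ F k
  least-spec k k< pos = let (l<y , l∈F , _) = min<-spec y _ (early k k< pos) in l<y , T⇒≡ l∈F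
  least-bound : ∀ k → k < 2 + y → 0 < F k → least k < y
  least-bound k k< pos = proj₁ (least-spec k k< pos)
  least-distinct : ∀ j k → j < k → k < 2 + y → 0 < F j → 0 < F k → least j ≢ least k
  least-distinct j k j<k k< posj posk same =
    F-disjoint j k j<k (least j) (proj₂ (least-spec j (<-trans j<k k<) posj))
               (subst (_∈ₛ F k) (sym same) (proj₂ (least-spec k k< posk)))

NU-singleton : ∀ (𝒮 : FinSet → Set) a → 𝒮 a → 0 < a → NU 𝒮 a
NU-singleton 𝒮 a a∈𝒮 0<a =
  nonempty-if-pos a 0<a , a ∷ [] , (λ { s (here refl) → a∈𝒮 }) ,
  λ i → mk⇔ (λ i∈a → a , here refl , i∈a) (λ { (s , here refl , i∈s) → i∈s })

∈ₛ-+ : ∀ y a b → (∀ i → y ≤ i → bit i a ≡ 0) → (∀ i → i < y → bit i b ≡ 0) →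
       ∀ i → i ∈ₛ (a + b) ⇔ (i ∈ₛ a ⊎ i ∈ₛ b)
∈ₛ-+ y a b a-below b-above i = mk⇔ to from
  where
  bit-sum : bit i (a + b) ≡ bit i a + bit i b
  bit-sum = bit-+ y a b a-below b-above i
  to : i ∈ₛ (a + b) → i ∈ₛ a ⊎ i ∈ₛ b
  to i∈a+b with bit i a ≟ 1
  ... | yes i∈a = inj₁ i∈a
  ... | no  i∉a = inj₂ (trans (sym (trans bit-sum (cong (_+ bit i b) (bit-≢1 i a i∉a)))) i∈a+b)
  from : i ∈ₛ a ⊎ i ∈ₛ b → i ∈ₛ (a + b)
  from (inj₁ i∈a) = trans bit-sum (trans (cong (bit i a +_) (b-above i i<y)) (trans (+-identityʳ _) i∈a))
    where i<y = ≰⇒> (λ y≤i → 0≢1+n (trans (sym (a-below i y≤i)) i∈a))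
  from (inj₂ i∈b) = trans bit-sum (trans (cong (_+ bit i b) (a-below i y≤i)) i∈b)
    where y≤i = ≮⇒≥ (λ i<y → 0≢1+n (trans (sym (b-above i i<y)) i∈b))

NU-join : ∀ (𝒮 : FinSet → Set) y a b → 𝒮 a → 𝒮 b → 0 < a →
          (∀ i → y ≤ i → bit i a ≡ 0) → (∀ i → i < y → bit i b ≡ 0) → NU 𝒮 (a + b)
NU-join 𝒮 y a b a∈𝒮 b∈𝒮 0<a a-below b-above =
  (i , Equivalence.from (∈ₛ-+ y a b a-below b-above i) (inj₁ i∈a)) , a ∷ b ∷ [] ,
  (λ { s (here refl) → a∈𝒮 ; s (there (here refl)) → b∈𝒮 }) ,
  λ j → mk⇔ (λ j∈a+b → to j (Equivalence.to (∈ₛ-+ y a b a-below b-above j) j∈a+b))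
            (λ j∈L → Equivalence.from (∈ₛ-+ y a b a-below b-above j) (from j j∈L))
  where
  i = proj₁ (nonempty-if-pos a 0<a)
  i∈a = proj₂ (nonempty-if-pos a 0<a)
  to : ∀ j → j ∈ₛ a ⊎ j ∈ₛ b → ∃ λ s → s ∈ a ∷ b ∷ [] × j ∈ₛ s
  to j (inj₁ j∈a) = a , here refl , j∈a
  to j (inj₂ j∈b) = b , there (here refl) , j∈b
  from : ∀ j → (∃ λ s → s ∈ a ∷ b ∷ [] × j ∈ₛ s) → j ∈ₛ a ⊎ j ∈ₛ b
  from j (s , here refl , j∈s)         = inj₁ j∈s
  from j (s , there (here refl) , j∈s) = inj₂ j∈s

open ColouringBy marked

c : FinSet → Bool
c x = colour x ≡ᵇ 1

c-computable : Computable c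
c-computable = let (p , eval) = repB-≡ᵇ (rep-colour rep-marked) (rep-const 1) in p , λ n → eval (n ∷ [])

c≡⇒colour≡ : ∀ x x′ → c x ≡ c x′ → colour x ≡ colour x′
c≡⇒colour≡ x x′ = ≡ᵇ1-injective (mod2≤1 (marks x)) (mod2≤1 (marks x′))
  where
  ≡ᵇ1-injective : ∀ {m n} → m ≤ 1 → n ≤ 1 → (m ≡ᵇ 1) ≡ (n ≡ᵇ 1) → m ≡ n
  ≡ᵇ1-injective {0}           {0}           _        _        _  = refl
  ≡ᵇ1-injective {1}           {1}           _        _        _  = refl
  ≡ᵇ1-injective {0}           {1}           _        _        ()
  ≡ᵇ1-injective {1}           {0}           _        _        ()
  ≡ᵇ1-injective {suc (suc _)} {_}           (s≤s ()) _        _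
  ≡ᵇ1-injective {_}           {suc (suc _)} _        (s≤s ()) _

-- Fix 𝒮 = dom e with its disjoint family F.  The stage y is the least element of a member b of F
-- that lies beyond all of F 0 , … , F (K ∸ 1) and beyond the stages at which e accepts them.
module Diagonal (𝒮 : FinSet → Set) (e : PR 1) (e-enum : ∀ n → 𝒮 n ⇔ (∃ λ v → Eval e (n ∷ []) v))
                (F : ℕ → FinSet) (F∈𝒮 : ∀ k → 𝒮 (F k)) (F-distinct : ∀ j k → j ≢ k → F j ≢ F k)
                (F-disjoint : ∀ j k → j ≢ k → Disjoint (F j) (F k)) where

  E : ℕ
  E = code e

  K : ℕ
  K = 3 + 2 * E

  halts : ∀ k → ∃ λ s → T (haltsWithin E (F k) s)
  halts k = let (v , ev) = Equivalence.to (e-enum (F k)) (F∈𝒮 k) in haltsWithin-complete e (F k) v ev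

  y₀ : ℕ
  y₀ = sum< K (λ k → proj₁ (halts k) + F k) + suc E

  b-spec : ∃ λ k → 0 < F k × (∀ i → i < y₀ → bit i (F k) ≡ 0)
  b-spec = member-beyond y₀ F (λ j k j<k → F-distinct j k (<⇒≢ j<k)) (λ j k j<k → F-disjoint j k (<⇒≢ j<k))

  b : FinSet
  b = F (proj₁ b-spec)

  y-spec : ∃ λ y → y ∈ₛ b × (∀ i → i < y → bit i b ≡ 0)
  y-spec = least-element b (proj₁ (proj₂ b-spec))

  y : ℕ
  y = proj₁ y-spec

  y∈b : y ∈ₛ b
  y∈b = proj₁ (proj₂ y-spec)

  b-above : ∀ i → i < y → bit i b ≡ 0
  b-above = proj₂ (proj₂ y-spec)

  y₀≤y : y₀ ≤ y
  y₀≤y = ≮⇒≥ (λ y<y₀ → 0≢1+n (trans (sym (proj₂ (proj₂ b-spec) y y<y₀)) y∈b))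

  E<y : E < y
  E<y = <-≤-trans (m≤n+m (suc E) _) y₀≤y

  early : ∀ k → k < K → F k < y × T (haltsWithin E (F k) y)
  early k k<K = <-≤-trans (s≤s (m≤n+m _ _)) below-y ,
                haltsWithin-mono E (F k) s y (≤-trans (m≤m+n s (F k)) (<⇒≤ below-y)) (proj₂ (halts k))
    where
    s = proj₁ (halts k)
    below-y : s + F k < y
    below-y = begin-strict
      s + F k                               ≤⟨ sum<-≤ K _ k k<K ⟩
      sum< K (λ k → proj₁ (halts k) + F k) <⟨ m<m+n _ (s≤s z≤n) ⟩
      y₀                                    ≤⟨ y₀≤y ⟩
      y                                     ∎
      where open ≤-Reasoning

  acting : T (acts E y (used E y))
  acting = acts-if-enumerated E y F enumerated-F (λ j k j<k _ → F-distinct j k (<⇒≢ j<k)) max-distinct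
    where
    enumerated-F : ∀ k → k < K → 0 < F k → T (enumerated E y (maxElem (F k)))
    enumerated-F k k<K pos = any<-intro y _ (F k) (proj₁ (early k k<K))
      (∧-intro (0 <ᵇ F k) (<⇒T pos)
               (∧-intro (maxElem (F k) ≡ᵇ maxElem (F k)) (≡⇒T {maxElem (F k)} refl) (proj₂ (early k k<K))))
    max-distinct : ∀ j k → j < k → k < K → 0 < F j → 0 < F k → maxElem (F j) ≢ maxElem (F k)
    max-distinct j k j<k _ posj posk same =
      F-disjoint j k (<⇒≢ j<k) (maxElem (F j)) (proj₁ (maxElem-∈ (F j) posj))
                 (subst (_∈ₛ F k) (sym same) (proj₁ (maxElem-∈ (F k) posk)))

  join-parity : ConstantOn c (NU 𝒮) → ∀ p → T (enumerated E y p) → mod2 (marks b + boolToℕ (marked p y)) ≡ 0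
  join-parity constant p p-enum with any<-elim y _ p-enum
  ... | (a , a<y , a-ok) = mod2-cancelˡ (marks a) _ (begin
    mod2 (marks a)
      ≡⟨ c≡⇒colour≡ a (a + b) (constant a (a + b) a∈NU ab∈NU) ⟩
    mod2 (marks (a + b))
      ≡⟨ cong mod2 (marks-join a b y 0<a a-below b-above y∈b) ⟩
    mod2 (marks a + marks b + boolToℕ (marked (maxElem a) y))
      ≡⟨ cong (λ q → mod2 (marks a + marks b + boolToℕ (marked q y))) max≡p ⟩
    mod2 (marks a + marks b + boolToℕ (marked p y))
      ≡⟨ cong mod2 (+-assoc (marks a) _ _) ⟩
    mod2 (marks a + (marks b + boolToℕ (marked p y)))
      ∎)
    where
    open ≡-Reasoning
    0<a : 0 < a
    0<a = T⇒< (∧-fst (0 <ᵇ a) a-ok)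
    max≡p : maxElem a ≡ p
    max≡p = T⇒≡ (∧-fst (maxElem a ≡ᵇ p) (∧-snd (0 <ᵇ a) a-ok))
    a∈𝒮 : 𝒮 a
    a∈𝒮 = Equivalence.from (e-enum a) (haltsWithin-sound e a y (∧-snd (maxElem a ≡ᵇ p) (∧-snd (0 <ᵇ a) a-ok)))
    a-below : ∀ i → y ≤ i → bit i a ≡ 0
    a-below i y≤i = bit-≢1 i a (λ i∈a → <⇒≱ (<-trans (∈ₛ⇒< i∈a) a<y) y≤i)
    a∈NU : NU 𝒮 a
    a∈NU = NU-singleton 𝒮 a a∈𝒮 0<a
    ab∈NU : NU 𝒮 (a + b)
    ab∈NU = NU-join 𝒮 y a b a∈𝒮 (F∈𝒮 _) 0<a a-below b-above

  colour-varies : ¬ ConstantOn c (NU 𝒮)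
  colour-varies constant = 0≢1+n (begin
    0                                          ≡⟨ sym (join-parity constant second second-enumerated) ⟩
    mod2 (marks b + boolToℕ (marked second y)) ≡⟨ cong (λ m → mod2 (marks b + boolToℕ m)) second-marked ⟩
    mod2 (marks b + 1)                         ≡⟨ cong mod2 (+-comm (marks b) 1) ⟩
    1 ∸ mod2 (marks b)                         ≡⟨ cong (1 ∸_) first-parity ⟩
    1                                          ∎)
    where
    open ≡-Reasoning
    U = used E y
    first = firstPick E y U
    second = secondPick E y U
    picks = acts-picks E y U acting
    second-enumerated : T (enumerated E y second)
    second-enumerated = ∧-fst (enumerated E y second) (proj₁ (proj₂ picks))
    second-marked : marked second y ≡ true
    second-marked = T⇒≡true (marked-secondPick E y E<y acting)
    first-parity : mod2 (marks b) ≡ 0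
    first-parity = subst (λ m → mod2 m ≡ 0) (+-identityʳ (marks b))
      (subst (λ m → mod2 (marks b + boolToℕ m) ≡ 0) (¬T⇒≡false (unmarked-firstPick E y acting))
             (join-parity constant first (∧-fst (enumerated E y first) (proj₁ picks))))

mainTheorem5 : Σ (FinSet → Bool) λ c → Computable c ×
  ((𝒮 : FinSet → Set) → CE 𝒮 → GeneratesIP 𝒮 → ¬ ConstantOn c (NU 𝒮))
mainTheorem5 = c , c-computable , λ 𝒮 (e , e-enum) (F , F∈𝒮 , F-distinct , F-disjoint) →
  Diagonal.colour-varies 𝒮 e e-enum F F∈𝒮 F-distinct F-disjoint
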